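{- Let $k\geq 2$, $\ell\geq 1$ be integers and $0<\epsilon<256^{ -k}$. Then there exists an integer $n_0>0$ such that if $G=(V,E)$ is a $k$-uniform hypergraph on $n\geq n_0$ vertices with $e(G)>(1-\epsilon)\binom{n}{k}$ whose edges are colored with $k+\ell$ colors, then $G$ contains a monochromatic $1$-core on at least $\left(\frac{k}{k+\ell}-\sqrt{\epsilon}\right)n$ vertices.
   Context: The $1$-core of a hypergraph is its largest induced subhypergraph with no isolated vertices. A monochromatic $1$-core of color $i$ is the $1$-core of the subhypergraph consisting of the edges of color $i$; equivalently its vertex set is the set of vertices incident with at least one edge of color $i$.
   Formalization: The parameter ε in $0<\epsilon<256^{ -k}$ ranges over the rationals. -}

module Defs where

open import Data.Nat using (ℕ; zero; suc)
open import Data.Integer using (+_)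
open import Data.Rational using (ℚ; _/_; 0ℚ)
open import Data.Fin using (Fin; _≟_)
open import Data.Fin.Subset using (Subset; ⊥; _∪_)
open import Data.List using (List; filter; foldr)
open import Relation.Binary.PropositionalEquality using (_≡_)

ℕ→ℚ : ℕ → ℚ
ℕ→ℚ n = + n / 1

-- the rational a / b (b is positive wherever it is used)
frac : ℕ → ℕ → ℚ
frac a zero    = 0ℚ
frac a (suc b) = + a / suc b

-- A hypergraph on vertex set Fin n is given by a list of edges (subsets of Fin n);
-- an edge colouring with c colours is a map from subsets to Fin c (only its
-- values on edges matter).
edgesOfColour : ∀ {n c} → (Subset n → Fin c) → List (Subset n) → Fin c → List (Subset n)
edgesOfColour col es i = filter (λ e → col e ≟ i) es

-- Vertex set of the monochromatic 1-core of colour i: all vertices incident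
-- with at least one edge of colour i.
monoCore : ∀ {n c} → (Subset n → Fin c) → List (Subset n) → Fin c → Subset n
monoCore col es i = foldr _∪_ ⊥ (edgesOfColour col es i)

{-# OPTIONS --safe #-}

-- Write U₁, …, U_K (K = k + ℓ) for the vertex sets of the monochromatic 1-cores.  An edge of
-- colour i lies inside Uᵢ, so fewer than ε·C(n,k) of the k-sets are contained in no Uᵢ.
-- Suppose the largest core has fewer than (k/K)·n vertices, so that each core misses at least
-- n/(k+1) vertices.  If r ≤ j cores each miss a 1/(k+1) fraction of a set V, then at least
-- j(j-1)⋯(j-r+1)·(2(k+1))⁻ʳ·C(|V|,j) of the j-subsets of V lie in none of them; this is proved
-- by induction on j, double counting the sets through their elements and averaging over V.
-- Applied to V = [n] ∖ {x} for the vertices x lying in fewer than k cores, and combined with a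
-- Stirling-type estimate, it shows that the set S of these vertices satisfies
-- |S|·16⁻ᵏ·C(n,k)/n < ε·C(n,k); as ε < 256⁻ᵏ this gives |S| ≤ √ε·n.  Every vertex outside S
-- lies in at least k cores, so K·maxᵢ|Uᵢ| ≥ Σᵢ|Uᵢ| ≥ k·(n − |S|).

module Submission where

module Counting where

  open import Algebra.Bundles using (CommutativeMonoid)
  import Algebra.Properties.CommutativeSemigroup as CommutativeSemigroupProperties
  open import Data.Bool using (Bool; true; false; not; _∧_; _∨_) renaming (_≟_ to _≟ᵇ_)
  open import Data.Bool.Properties
    using (T-≡; ∧-commutativeMonoid; ∧-conicalˡ; ∧-conicalʳ; ∧-assoc; ∧-comm; ∧-zeroʳ; ∧-identityʳ; ∨-zeroʳ)
  open import Data.Empty using (⊥-elim)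
  open import Data.Fin using (Fin; zero; suc) renaming (_≟_ to _≟ᶠ_)
  open import Data.Fin.Subset using (Subset; ⊤; ⊥; ⁅_⁆; _∪_; _─_; _-_; ∣_∣; _⊆_)
  open import Data.Fin.Subset.Properties
    using (∣⊤∣≡n; ∣⊥∣≡0; ∣p─q∣≤∣p∣; p─⊥≡p; ∪-identityˡ; drop-∷-⊆; p⊆p∪q; q⊆p∪q; ⊆-trans)
  open import Data.List using (List; []; _∷_; length; allFin)
  import Data.List as List
  open import Data.List.Extrema.Nat using (argmax; f[xs]≤f[argmax])
  open import Data.List.Membership.Propositional using (_∈_)
  open import Data.List.Membership.Propositional.Properties using (∈-filter⁺; ∈-allFin)
  open import Data.List.Relation.Unary.All as All using (All; []; _∷_)
  open import Data.List.Relation.Unary.AllPairs using ([]; _∷_)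
  open import Data.List.Relation.Unary.Any using (here; there)
  open import Data.List.Relation.Unary.Unique.Propositional using (Unique)
  open import Data.Nat hiding (∣_-_∣)
  open import Data.Nat.Combinatorics using (_C_; nC1≡n; nCk+nC[k+1]≡[n+1]C[k+1])
  open import Data.Nat.Combinatorics.Base using (_P′_)
  open import Data.Nat.Combinatorics.Specification using (nP′k≡n[n∸1P′k∸1]; nP′n≡n!)
  open import Data.Nat.Properties
  open import Data.Nat.Tactic.RingSolver using (solve-∀)
  open import Data.Product using (_×_; _,_)
  open import Data.Vec using ([]; _∷_; lookup) renaming (here to here′)
  open import Data.Vec.Functional using (foldr)
  open import Data.Vec.Properties using (≡-dec; lookup-replicate)
  open import Defs using (monoCore)
  open import Function using (_∘_; Equivalence)
  open import Relation.Binary.Definitions using (DecidableEquality)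
  open import Relation.Binary.PropositionalEquality
  open import Relation.Nullary using (does; yes; no)
  open import Relation.Nullary.Reflects using (ofʸ; ofⁿ)
  open import Algebra.Properties.Semiring.Sum +-*-semiring
    using (sum; sum-syntax; sum-cong-≗; ∑-distrib-+; ∑-comm; *-distribˡ-sum; *-distribʳ-sum)
  open CommutativeSemigroupProperties +-commutativeSemigroup using () renaming (interchange to +-interchange)
  open CommutativeSemigroupProperties *-commutativeSemigroup using (x∙yz≈y∙xz)
  open CommutativeSemigroupProperties (CommutativeMonoid.commutativeSemigroup ∧-commutativeMonoid)
    using () renaming (x∙yz≈y∙xz to ∧-left-comm)

  ⟦_⟧ : Bool → ℕ
  ⟦ true ⟧  = 1
  ⟦ false ⟧ = 0

  ⟦∧⟧ : ∀ a b → ⟦ a ∧ b ⟧ ≡ ⟦ a ⟧ * ⟦ b ⟧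
  ⟦∧⟧ true  b = sym (*-identityˡ ⟦ b ⟧)
  ⟦∧⟧ false b = refl

  ⟦⟧-split : ∀ a b → ⟦ a ⟧ ≡ ⟦ a ∧ b ⟧ + ⟦ a ∧ not b ⟧
  ⟦⟧-split true  true  = refl
  ⟦⟧-split true  false = refl
  ⟦⟧-split false b     = refl

  sum-mono-≤ : ∀ {n} {f g : Fin n → ℕ} → (∀ i → f i ≤ g i) → sum f ≤ sum g
  sum-mono-≤ {zero}  f≤g = z≤n
  sum-mono-≤ {suc n} f≤g = +-mono-≤ (f≤g zero) (sum-mono-≤ (f≤g ∘ suc))

  sum-const : ∀ n c → ∑[ i < n ] c ≡ n * c
  sum-const zero    c = refl
  sum-const (suc n) c = cong (c +_) (sum-const n c)

  -- Sums over all subsets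

  ∑ₛ : ∀ {n} → (Subset n → ℕ) → ℕ
  ∑ₛ {zero}  f = f []
  ∑ₛ {suc n} f = ∑ₛ (λ T → f (false ∷ T)) + ∑ₛ (λ T → f (true ∷ T))

  ∑ₛ-cong : ∀ {n} {f g : Subset n → ℕ} → (∀ T → f T ≡ g T) → ∑ₛ f ≡ ∑ₛ g
  ∑ₛ-cong {zero}  f≗g = f≗g []
  ∑ₛ-cong {suc n} f≗g = cong₂ _+_ (∑ₛ-cong (f≗g ∘ (false ∷_))) (∑ₛ-cong (f≗g ∘ (true ∷_)))

  ∑ₛ-zero : ∀ n → ∑ₛ {n} (λ _ → 0) ≡ 0
  ∑ₛ-zero zero    = refl
  ∑ₛ-zero (suc n) = cong₂ _+_ (∑ₛ-zero n) (∑ₛ-zero n)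

  ∑ₛ-distrib-+ : ∀ {n} (f g : Subset n → ℕ) → ∑ₛ (λ T → f T + g T) ≡ ∑ₛ f + ∑ₛ g
  ∑ₛ-distrib-+ {zero}  f g = refl
  ∑ₛ-distrib-+ {suc n} f g = begin
    ∑ₛ (λ T → f₀ T + g₀ T) + ∑ₛ (λ T → f₁ T + g₁ T)
      ≡⟨ cong₂ _+_ (∑ₛ-distrib-+ f₀ g₀) (∑ₛ-distrib-+ f₁ g₁) ⟩
    (∑ₛ f₀ + ∑ₛ g₀) + (∑ₛ f₁ + ∑ₛ g₁)
      ≡⟨ +-interchange (∑ₛ f₀) (∑ₛ g₀) (∑ₛ f₁) (∑ₛ g₁) ⟩
    (∑ₛ f₀ + ∑ₛ f₁) + (∑ₛ g₀ + ∑ₛ g₁) ∎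
    where
    open ≡-Reasoning
    f₀ f₁ g₀ g₁ : Subset n → ℕ
    f₀ = f ∘ (false ∷_)
    f₁ = f ∘ (true ∷_)
    g₀ = g ∘ (false ∷_)
    g₁ = g ∘ (true ∷_)

  *-distribˡ-∑ₛ : ∀ {n} c (f : Subset n → ℕ) → c * ∑ₛ f ≡ ∑ₛ (λ T → c * f T)
  *-distribˡ-∑ₛ {zero}  c f = refl
  *-distribˡ-∑ₛ {suc n} c f = trans (*-distribˡ-+ c _ _)
    (cong₂ _+_ (*-distribˡ-∑ₛ c (f ∘ (false ∷_))) (*-distribˡ-∑ₛ c (f ∘ (true ∷_))))

  ∑ₛ-∑-comm : ∀ {n m} (h : Fin m → Subset n → ℕ) →
    ∑ₛ (λ T → ∑[ x < m ] h x T) ≡ ∑[ x < m ] ∑ₛ (h x)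
  ∑ₛ-∑-comm {n} {zero}  h = ∑ₛ-zero n
  ∑ₛ-∑-comm {n} {suc m} h =
    trans (∑ₛ-distrib-+ (h zero) _) (cong (∑ₛ (h zero) +_) (∑ₛ-∑-comm (h ∘ suc)))

  f≤∑ₛf : ∀ {n} (f : Subset n → ℕ) T → f T ≤ ∑ₛ f
  f≤∑ₛf f []          = ≤-refl
  f≤∑ₛf f (false ∷ T) = ≤-trans (f≤∑ₛf (f ∘ (false ∷_)) T) (m≤m+n _ _)
  f≤∑ₛf f (true ∷ T)  = ≤-trans (f≤∑ₛf (f ∘ (true ∷_)) T) (m≤n+m _ _)

  infix 4 _⊆ᵇ_

  _⊆ᵇ_ : ∀ {n} → Subset n → Subset n → Bool
  []      ⊆ᵇ []      = true
  (a ∷ p) ⊆ᵇ (b ∷ q) = (not a ∨ b) ∧ (p ⊆ᵇ q)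

  ⊆⇒⊆ᵇ : ∀ {n} {p q : Subset n} → p ⊆ q → (p ⊆ᵇ q) ≡ true
  ⊆⇒⊆ᵇ {p = []}        {[]}        p⊆q = refl
  ⊆⇒⊆ᵇ {p = false ∷ p} {b ∷ q}     p⊆q = ⊆⇒⊆ᵇ (drop-∷-⊆ p⊆q)
  ⊆⇒⊆ᵇ {p = true ∷ p}  {true ∷ q}  p⊆q = ⊆⇒⊆ᵇ (drop-∷-⊆ p⊆q)
  ⊆⇒⊆ᵇ {p = true ∷ p}  {false ∷ q} p⊆q with p⊆q here′
  ... | ()

  p⊆ᵇ⊤ : ∀ {n} (p : Subset n) → (p ⊆ᵇ ⊤) ≡ true
  p⊆ᵇ⊤ []      = refl
  p⊆ᵇ⊤ (a ∷ p) rewrite ∨-zeroʳ (not a) = p⊆ᵇ⊤ p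

  ⊥⊆ᵇp : ∀ {n} (p : Subset n) → (⊥ ⊆ᵇ p) ≡ true
  ⊥⊆ᵇp []      = refl
  ⊥⊆ᵇp (b ∷ p) = ⊥⊆ᵇp p

  ⁅x⁆∪p⊆ᵇq : ∀ {n} (x : Fin n) (p q : Subset n) → (⁅ x ⁆ ∪ p ⊆ᵇ q) ≡ lookup q x ∧ (p ⊆ᵇ q)
  ⁅x⁆∪p⊆ᵇq zero    (a ∷ p)     (false ∷ q) = refl
  ⁅x⁆∪p⊆ᵇq zero    (true ∷ p)  (true ∷ q)  = cong (_⊆ᵇ q) (∪-identityˡ p)
  ⁅x⁆∪p⊆ᵇq zero    (false ∷ p) (true ∷ q)  = cong (_⊆ᵇ q) (∪-identityˡ p)
  ⁅x⁆∪p⊆ᵇq (suc x) (a ∷ p) (b ∷ q) = begin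
    (not a ∨ b) ∧ (⁅ x ⁆ ∪ p ⊆ᵇ q)          ≡⟨ cong ((not a ∨ b) ∧_) (⁅x⁆∪p⊆ᵇq x p q) ⟩
    (not a ∨ b) ∧ (lookup q x ∧ (p ⊆ᵇ q))   ≡⟨ ∧-left-comm (not a ∨ b) (lookup q x) (p ⊆ᵇ q) ⟩
    lookup q x ∧ ((not a ∨ b) ∧ (p ⊆ᵇ q))   ∎
    where open ≡-Reasoning

  p⊆ᵇq-x : ∀ {n} (p q : Subset n) x → (p ⊆ᵇ q - x) ≡ not (lookup p x) ∧ (p ⊆ᵇ q)
  p⊆ᵇq-x (true ∷ p)  (b ∷ q) zero = refl
  p⊆ᵇq-x (false ∷ p) (b ∷ q) zero = cong (p ⊆ᵇ_) (p─⊥≡p q)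
  p⊆ᵇq-x (a ∷ p) (b ∷ q) (suc x) = begin
    (not a ∨ b) ∧ (p ⊆ᵇ q - x)                   ≡⟨ cong ((not a ∨ b) ∧_) (p⊆ᵇq-x p q x) ⟩
    (not a ∨ b) ∧ (not (lookup p x) ∧ (p ⊆ᵇ q))  ≡⟨ ∧-left-comm (not a ∨ b) _ (p ⊆ᵇ q) ⟩
    not (lookup p x) ∧ ((not a ∨ b) ∧ (p ⊆ᵇ q))  ∎
    where open ≡-Reasoning

  ∣∷∣-cong : ∀ {n} a {p q : Subset n} → ∣ p ∣ ≡ ∣ q ∣ → ∣ a ∷ p ∣ ≡ ∣ a ∷ q ∣
  ∣∷∣-cong true  e = cong suc e
  ∣∷∣-cong false e = e

  ∣p∣≡∑ : ∀ {n} (p : Subset n) → ∣ p ∣ ≡ ∑[ x < n ] ⟦ lookup p x ⟧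
  ∣p∣≡∑ []          = refl
  ∣p∣≡∑ (true ∷ p)  = cong suc (∣p∣≡∑ p)
  ∣p∣≡∑ (false ∷ p) = ∣p∣≡∑ p

  ∣p─q∣≡∑ : ∀ {n} (p q : Subset n) → ∣ p ─ q ∣ ≡ ∑[ x < n ] ⟦ lookup p x ∧ not (lookup q x) ⟧
  ∣p─q∣≡∑ []          []          = refl
  ∣p─q∣≡∑ (true ∷ p)  (false ∷ q) = cong suc (∣p─q∣≡∑ p q)
  ∣p─q∣≡∑ (true ∷ p)  (true ∷ q)  = ∣p─q∣≡∑ p q
  ∣p─q∣≡∑ (false ∷ p) (true ∷ q)  = ∣p─q∣≡∑ p q
  ∣p─q∣≡∑ (false ∷ p) (false ∷ q) = ∣p─q∣≡∑ p q

  ∣p∣+∣⊤─p∣≡n : ∀ {n} (p : Subset n) → ∣ p ∣ + ∣ ⊤ ─ p ∣ ≡ n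
  ∣p∣+∣⊤─p∣≡n []          = refl
  ∣p∣+∣⊤─p∣≡n (true ∷ p)  = cong suc (∣p∣+∣⊤─p∣≡n p)
  ∣p∣+∣⊤─p∣≡n (false ∷ p) = trans (+-suc ∣ p ∣ _) (cong suc (∣p∣+∣⊤─p∣≡n p))

  ∣⁅x⁆∪p∣ : ∀ {n} x (p : Subset n) → lookup p x ≡ false → ∣ ⁅ x ⁆ ∪ p ∣ ≡ suc ∣ p ∣
  ∣⁅x⁆∪p∣ zero    (false ∷ p) refl = cong (suc ∘ ∣_∣) (∪-identityˡ p)
  ∣⁅x⁆∪p∣ (suc x) (true ∷ p)  x∉p  = cong suc (∣⁅x⁆∪p∣ x p x∉p)
  ∣⁅x⁆∪p∣ (suc x) (false ∷ p) x∉p  = ∣⁅x⁆∪p∣ x p x∉p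

  suc∣p-x∣ : ∀ {n} (p : Subset n) x → lookup p x ≡ true → suc ∣ p - x ∣ ≡ ∣ p ∣
  suc∣p-x∣ (true ∷ p)  zero    refl = cong (suc ∘ ∣_∣) (p─⊥≡p p)
  suc∣p-x∣ (true ∷ p)  (suc x) x∈p  = cong suc (suc∣p-x∣ p x x∈p)
  suc∣p-x∣ (false ∷ p) (suc x) x∈p  = suc∣p-x∣ p x x∈p

  ∣p-x─q∣ : ∀ {n} (p q : Subset n) x → lookup q x ≡ true → ∣ p - x ─ q ∣ ≡ ∣ p ─ q ∣
  ∣p-x─q∣ (a ∷ p) (true ∷ q)  zero    refl = cong (λ r → ∣ r ─ q ∣) (p─⊥≡p p)
  ∣p-x─q∣ (a ∷ p) (true ∷ q)  (suc x) x∈q  = ∣p-x─q∣ p q x x∈q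
  ∣p-x─q∣ (a ∷ p) (false ∷ q) (suc x) x∈q  = ∣∷∣-cong a {p - x ─ q} {p ─ q} (∣p-x─q∣ p q x x∈q)

  ∣p-x∣≤c*∣p-x─q∣ : ∀ {n c} (p q : Subset n) x → lookup q x ≡ true →
    ∣ p ∣ ≤ c * ∣ p ─ q ∣ → ∣ p - x ∣ ≤ c * ∣ p - x ─ q ∣
  ∣p-x∣≤c*∣p-x─q∣ p q x x∈q ∣p∣≤c*∣p─q∣ rewrite ∣p-x─q∣ p q x x∈q =
    ≤-trans (∣p─q∣≤∣p∣ p ⁅ x ⁆) ∣p∣≤c*∣p─q∣

  ∑ₛ-size≡C : ∀ n k → ∑ₛ {n} (λ T → ⟦ ∣ T ∣ ≡ᵇ k ⟧) ≡ n C k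
  ∑ₛ-size≡C zero    zero    = refl
  ∑ₛ-size≡C zero    (suc k) = refl
  ∑ₛ-size≡C (suc n) zero    = cong₂ _+_ (∑ₛ-size≡C n 0) (∑ₛ-zero n)
  ∑ₛ-size≡C (suc n) (suc k) = begin
    ∑ₛ {n} (λ T → ⟦ ∣ T ∣ ≡ᵇ suc k ⟧) + ∑ₛ {n} (λ T → ⟦ ∣ T ∣ ≡ᵇ k ⟧)
      ≡⟨ cong₂ _+_ (∑ₛ-size≡C n (suc k)) (∑ₛ-size≡C n k) ⟩
    n C suc k + n C k  ≡⟨ +-comm (n C suc k) (n C k) ⟩
    n C k + n C suc k  ≡⟨ nCk+nC[k+1]≡[n+1]C[k+1] n k ⟩
    suc n C suc k      ∎
    where open ≡-Reasoning

  [1+k]*nC[1+k]≡n*[n-1]Ck : ∀ n k → suc k * (n C suc k) ≡ n * (pred n C k)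
  [1+k]*nC[1+k]≡n*[n-1]Ck zero          k       = *-zeroʳ (suc k)
  [1+k]*nC[1+k]≡n*[n-1]Ck (suc zero)    zero    = refl
  [1+k]*nC[1+k]≡n*[n-1]Ck (suc zero)    (suc k) = *-zeroʳ (2 + k)
  [1+k]*nC[1+k]≡n*[n-1]Ck (suc (suc n)) zero    =
    trans (+-identityʳ _) (trans (nC1≡n (2 + n)) (sym (*-identityʳ (2 + n))))
  [1+k]*nC[1+k]≡n*[n-1]Ck (suc (suc n)) (suc k) = begin
    (2 + k) * ((2 + n) C (2 + k))              ≡⟨ cong ((2 + k) *_) (nCk+nC[k+1]≡[n+1]C[k+1] (suc n) (suc k)) ⟨
    (2 + k) * (a + b)                          ≡⟨ split k a b ⟩
    a + suc k * a + (2 + k) * b                ≡⟨ cong₂ (λ u v → a + u + v) ([1+k]*nC[1+k]≡n*[n-1]Ck (suc n) k)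
                                                                            ([1+k]*nC[1+k]≡n*[n-1]Ck (suc n) (suc k)) ⟩
    a + suc n * (n C k) + suc n * (n C suc k)  ≡⟨ join n a (n C k) (n C suc k) ⟩
    a + suc n * (n C k + n C suc k)            ≡⟨ cong (λ u → a + suc n * u) (nCk+nC[k+1]≡[n+1]C[k+1] n k) ⟩
    a + suc n * a                              ∎
    where
    open ≡-Reasoning
    a b : ℕ
    a = suc n C suc k
    b = suc n C (2 + k)
    split : ∀ k a b → (2 + k) * (a + b) ≡ a + suc k * a + (2 + k) * b
    split = solve-∀
    join : ∀ n a x y → a + suc n * x + suc n * y ≡ a + suc n * (x + y)
    join = solve-∀

  ∑ₛ-insert : ∀ {n} x (f : Subset n → ℕ) →
    ∑ₛ (λ T → ⟦ lookup T x ⟧ * f T) ≡ ∑ₛ (λ T → ⟦ not (lookup T x) ⟧ * f (⁅ x ⁆ ∪ T))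
  ∑ₛ-insert {suc n} zero f = begin
    ∑ₛ {n} (λ _ → 0) + ∑ₛ (λ T → f (true ∷ T) + 0)        ≡⟨ cong (_+ ∑ₛ (λ T → f (true ∷ T) + 0)) (∑ₛ-zero n) ⟩
    ∑ₛ (λ T → f (true ∷ T) + 0)                           ≡⟨ ∑ₛ-cong (λ T → cong (λ r → f (true ∷ r) + 0) (∪-identityˡ T)) ⟨
    ∑ₛ (λ T → f (true ∷ (⊥ ∪ T)) + 0)                     ≡⟨ +-identityʳ _ ⟨
    ∑ₛ (λ T → f (true ∷ (⊥ ∪ T)) + 0) + 0                 ≡⟨ cong (∑ₛ (λ T → f (true ∷ (⊥ ∪ T)) + 0) +_) (∑ₛ-zero n) ⟨
    ∑ₛ (λ T → f (true ∷ (⊥ ∪ T)) + 0) + ∑ₛ {n} (λ _ → 0) ∎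
    where open ≡-Reasoning
  ∑ₛ-insert {suc n} (suc x) f =
    cong₂ _+_ (∑ₛ-insert x (f ∘ (false ∷_))) (∑ₛ-insert x (f ∘ (true ∷_)))

  ∑ₛ-double-count : ∀ {n} (f : Subset n → ℕ) →
    ∑ₛ (λ T → ∣ T ∣ * f T) ≡ ∑[ x < n ] ∑ₛ (λ T → ⟦ not (lookup T x) ⟧ * f (⁅ x ⁆ ∪ T))
  ∑ₛ-double-count {n} f = begin
    ∑ₛ (λ T → ∣ T ∣ * f T)
      ≡⟨ ∑ₛ-cong (λ T → trans (cong (_* f T) (∣p∣≡∑ T)) (*-distribʳ-sum (f T) (λ x → ⟦ lookup T x ⟧))) ⟩
    ∑ₛ (λ T → ∑[ x < n ] (⟦ lookup T x ⟧ * f T))  ≡⟨ ∑ₛ-∑-comm (λ x T → ⟦ lookup T x ⟧ * f T) ⟩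
    ∑[ x < n ] ∑ₛ (λ T → ⟦ lookup T x ⟧ * f T)    ≡⟨ sum-cong-≗ (λ x → ∑ₛ-insert x f) ⟩
    ∑[ x < n ] ∑ₛ (λ T → ⟦ not (lookup T x) ⟧ * f (⁅ x ⁆ ∪ T)) ∎
    where open ≡-Reasoning

  _≟ₛ_ : ∀ {n} → DecidableEquality (Subset n)
  _≟ₛ_ = ≡-dec _≟ᵇ_

  ∑ₛ-⟦≟⟧ : ∀ {n} (h : Subset n → ℕ) E → ∑ₛ (λ T → ⟦ does (T ≟ₛ E) ⟧ * h T) ≡ h E
  ∑ₛ-⟦≟⟧ h [] = +-identityʳ (h [])
  ∑ₛ-⟦≟⟧ {suc n} h (false ∷ E) =
    trans (cong₂ _+_ (∑ₛ-⟦≟⟧ (h ∘ (false ∷_)) E) (∑ₛ-zero n)) (+-identityʳ (h (false ∷ E)))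
  ∑ₛ-⟦≟⟧ {suc n} h (true ∷ E) = cong₂ _+_ (∑ₛ-zero n) (∑ₛ-⟦≟⟧ (h ∘ (true ∷_)) E)

  ∑ₛ-remove : ∀ {n} (p : Subset n → Bool) E →
    ∑ₛ (λ T → ⟦ p T ⟧) ≡ ⟦ p E ⟧ + ∑ₛ (λ T → ⟦ p T ∧ not (does (T ≟ₛ E)) ⟧)
  ∑ₛ-remove p E = begin
    ∑ₛ (λ T → ⟦ p T ⟧)                                 ≡⟨ ∑ₛ-cong (λ T → ⟦⟧-split (p T) (isE T)) ⟩
    ∑ₛ (λ T → ⟦ p T ∧ isE T ⟧ + ⟦ p T ∧ not (isE T) ⟧) ≡⟨ ∑ₛ-distrib-+ (λ T → ⟦ p T ∧ isE T ⟧) rest ⟩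
    ∑ₛ (λ T → ⟦ p T ∧ isE T ⟧) + ∑ₛ rest               ≡⟨ cong (_+ ∑ₛ rest) (∑ₛ-cong reorder) ⟩
    ∑ₛ (λ T → ⟦ isE T ⟧ * ⟦ p T ⟧) + ∑ₛ rest           ≡⟨ cong (_+ ∑ₛ rest) (∑ₛ-⟦≟⟧ (λ T → ⟦ p T ⟧) E) ⟩
    ⟦ p E ⟧ + ∑ₛ rest                                  ∎
    where
    open ≡-Reasoning
    isE : Subset _ → Bool
    isE T = does (T ≟ₛ E)
    rest : Subset _ → ℕ
    rest T = ⟦ p T ∧ not (isE T) ⟧
    reorder : ∀ T → ⟦ p T ∧ isE T ⟧ ≡ ⟦ isE T ⟧ * ⟦ p T ⟧
    reorder T = trans (cong ⟦_⟧ (∧-comm (p T) (isE T))) (⟦∧⟧ (isE T) (p T))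

  length≤∑ₛ : ∀ {n} (p : Subset n → Bool) (L : List (Subset n)) →
    Unique L → All (λ T → p T ≡ true) L → length L ≤ ∑ₛ (λ T → ⟦ p T ⟧)
  length≤∑ₛ p []      []         []         = z≤n
  length≤∑ₛ p (E ∷ L) (E∉L ∷ uL) (pE ∷ pL) rewrite ∑ₛ-remove p E | pE =
    s≤s (length≤∑ₛ _ L uL (All.zipWith p∧≢E (E∉L , pL)))
    where
    p∧≢E : ∀ {T} → E ≢ T × p T ≡ true → (p T ∧ not (does (T ≟ₛ E))) ≡ true
    p∧≢E {T} (E≢T , pT) with T ≟ₛ E
    ... | yes T≡E = ⊥-elim (E≢T (sym T≡E))
    ... | no _    = trans (∧-identityʳ (p T)) pT

  -- Sets contained in no core

  anyᵇ : ∀ {K} → (Fin K → Bool) → Bool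
  anyᵇ = foldr _∨_ false

  anyᵇ-cong : ∀ {K} {f g : Fin K → Bool} → (∀ i → f i ≡ g i) → anyᵇ f ≡ anyᵇ g
  anyᵇ-cong {zero}  f≗g = refl
  anyᵇ-cong {suc K} f≗g = cong₂ _∨_ (f≗g zero) (anyᵇ-cong (f≗g ∘ suc))

  anyᵇ-true : ∀ {K} (f : Fin K → Bool) i → f i ≡ true → anyᵇ f ≡ true
  anyᵇ-true f zero    fi = cong (_∨ anyᵇ (f ∘ suc)) fi
  anyᵇ-true f (suc i) fi = trans (cong (f zero ∨_) (anyᵇ-true (f ∘ suc) i fi)) (∨-zeroʳ (f zero))

  anyᵇ-false : ∀ {K} (f : Fin K → Bool) → (∀ i → f i ≡ false) → anyᵇ f ≡ false
  anyᵇ-false {zero}  f f≡false = refl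
  anyᵇ-false {suc K} f f≡false rewrite f≡false zero = anyᵇ-false (f ∘ suc) (f≡false ∘ suc)

  ∣_∣ᶠ : ∀ {K} → (Fin K → Bool) → ℕ
  ∣ R ∣ᶠ = ∑[ i < _ ] ⟦ R i ⟧

  ⊤ᶠ : ∀ {K} → Fin K → Bool
  ⊤ᶠ _ = true

  _∩ᶠ_ : ∀ {K} → (Fin K → Bool) → (Fin K → Bool) → Fin K → Bool
  (R ∩ᶠ S) i = R i ∧ S i

  ∣∩ᶠ∣+∣∩ᶠ∁∣ : ∀ {K} (R S : Fin K → Bool) → ∣ R ∩ᶠ S ∣ᶠ + ∣ R ∩ᶠ (not ∘ S) ∣ᶠ ≡ ∣ R ∣ᶠ
  ∣∩ᶠ∣+∣∩ᶠ∁∣ R S = trans (sym (∑-distrib-+ (λ i → ⟦ R i ∧ S i ⟧) (λ i → ⟦ R i ∧ not (S i) ⟧)))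
                         (sum-cong-≗ (λ i → sym (⟦⟧-split (R i) (S i))))

  ∣R∣ᶠ≡0⇒R≗false : ∀ {K} (R : Fin K → Bool) → ∣ R ∣ᶠ ≡ 0 → ∀ i → R i ≡ false
  ∣R∣ᶠ≡0⇒R≗false {suc K} R ∣R∣≡0 i with R zero in R₀
  ∣R∣ᶠ≡0⇒R≗false {suc K} R ()     i       | true
  ∣R∣ᶠ≡0⇒R≗false {suc K} R ∣R∣≡0 zero    | false = R₀
  ∣R∣ᶠ≡0⇒R≗false {suc K} R ∣R∣≡0 (suc i) | false = ∣R∣ᶠ≡0⇒R≗false (R ∘ suc) ∣R∣≡0 i

  module _ {n K} (U : Fin K → Subset n) where

    coveredBy : (Fin K → Bool) → Subset n → Bool
    coveredBy R T = anyᵇ (λ i → R i ∧ (T ⊆ᵇ U i))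

    uncovered : (Fin K → Bool) → Subset n → ℕ → Subset n → Bool
    uncovered R V j T = (T ⊆ᵇ V) ∧ (∣ T ∣ ≡ᵇ j) ∧ not (coveredBy R T)

    #uncovered : (Fin K → Bool) → Subset n → ℕ → ℕ
    #uncovered R V j = ∑ₛ λ T → ⟦ uncovered R V j T ⟧

    containing avoiding : Fin n → Fin K → Bool
    containing x i = lookup (U i) x
    avoiding x i = not (lookup (U i) x)

    coveredBy-insert : ∀ R x T → coveredBy R (⁅ x ⁆ ∪ T) ≡ coveredBy (R ∩ᶠ containing x) T
    coveredBy-insert R x T = anyᵇ-cong λ i →
      trans (cong (R i ∧_) (⁅x⁆∪p⊆ᵇq x T (U i))) (sym (∧-assoc (R i) (lookup (U i) x) (T ⊆ᵇ U i)))

    -- A set containing x is contained in no core that avoids x.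
    #uncovered-double-count : ∀ R V j →
      suc j * #uncovered R V (suc j) ≡ ∑[ x < n ] (⟦ lookup V x ⟧ * #uncovered (R ∩ᶠ containing x) (V - x) j)
    #uncovered-double-count R V j = begin
      suc j * #uncovered R V (suc j)                              ≡⟨ *-distribˡ-∑ₛ (suc j) F ⟩
      ∑ₛ (λ T → suc j * F T)                                      ≡⟨ ∑ₛ-cong size-weight ⟩
      ∑ₛ (λ T → ∣ T ∣ * F T)                                      ≡⟨ ∑ₛ-double-count F ⟩
      ∑[ x < n ] ∑ₛ (λ T → ⟦ not (lookup T x) ⟧ * F (⁅ x ⁆ ∪ T)) ≡⟨ sum-cong-≗ (λ x → ∑ₛ-cong (insert-term x)) ⟩
      ∑[ x < n ] ∑ₛ (λ T → ⟦ lookup V x ⟧ * G x T)                ≡⟨ sum-cong-≗ (λ x → *-distribˡ-∑ₛ ⟦ lookup V x ⟧ (G x)) ⟨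
      ∑[ x < n ] (⟦ lookup V x ⟧ * #uncovered (R ∩ᶠ containing x) (V - x) j) ∎
      where
      open ≡-Reasoning
      F : Subset n → ℕ
      F T = ⟦ uncovered R V (suc j) T ⟧
      G : Fin n → Subset n → ℕ
      G x T = ⟦ uncovered (R ∩ᶠ containing x) (V - x) j T ⟧
      size-weight : ∀ T → suc j * F T ≡ ∣ T ∣ * F T
      size-weight T with ∣ T ∣ ≡ᵇ suc j in eq
      ... | true  rewrite ≡ᵇ⇒≡ ∣ T ∣ (suc j) (Equivalence.from T-≡ eq) = refl
      ... | false rewrite ∧-zeroʳ (T ⊆ᵇ V) = trans (*-zeroʳ (suc j)) (sym (*-zeroʳ ∣ T ∣))
      insert-term : ∀ x T → ⟦ not (lookup T x) ⟧ * F (⁅ x ⁆ ∪ T) ≡ ⟦ lookup V x ⟧ * G x T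
      insert-term x T with lookup T x in x∈T
      ... | true  rewrite p⊆ᵇq-x T V x | x∈T = sym (*-zeroʳ ⟦ lookup V x ⟧)
      ... | false rewrite p⊆ᵇq-x T V x | x∈T | ⁅x⁆∪p⊆ᵇq x T V | ∣⁅x⁆∪p∣ x T x∈T | coveredBy-insert R x T
        = trans (+-identityʳ _) (trans (cong ⟦_⟧ (∧-assoc (lookup V x) (T ⊆ᵇ V) _)) (⟦∧⟧ (lookup V x) _))

  -- Falling factorials: j P′ r = j (j - 1) ⋯ (j - r + 1), which is 0 for r > j.

  *-P′-+-≤ : ∀ {j c} r d → j ≤ c → suc d * (j P′ (r + d)) ≤ (2 * c) ^ d * (j P′ r)
  *-P′-+-≤         r zero    j≤c rewrite +-identityʳ r = ≤-refl
  *-P′-+-≤ {j} {c} r (suc d) j≤c rewrite +-suc r d = begin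
    (2 + d) * ((j ∸ (r + d)) * (j P′ (r + d))) ≤⟨ *-mono-≤ (2+d≤2*[1+d] d) (*-monoˡ-≤ (j P′ (r + d)) j∸[r+d]≤c) ⟩
    (2 * suc d) * (c * (j P′ (r + d)))         ≡⟨ reassoc (suc d) c (j P′ (r + d)) ⟩
    (2 * c) * (suc d * (j P′ (r + d)))         ≤⟨ *-monoʳ-≤ (2 * c) (*-P′-+-≤ r d j≤c) ⟩
    (2 * c) * ((2 * c) ^ d * (j P′ r))         ≡⟨ *-assoc (2 * c) _ (j P′ r) ⟨
    (2 * c) ^ suc d * (j P′ r)                 ∎
    where
    open ≤-Reasoning
    j∸[r+d]≤c : j ∸ (r + d) ≤ c
    j∸[r+d]≤c = ≤-trans (m∸n≤m j (r + d)) j≤c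
    2+d≤2*[1+d] : ∀ d → 2 + d ≤ 2 * suc d
    2+d≤2*[1+d] d = subst (2 + d ≤_) (cong suc (sym (+-suc d (d + 0)))) (+-monoʳ-≤ 2 (m≤m+n d (d + 0)))
    reassoc : ∀ a b c → (2 * a) * (b * c) ≡ (2 * b) * (a * c)
    reassoc = solve-∀

  P′-+-≤ : ∀ {j c} r d → j ≤ c → j P′ (r + d) ≤ (2 * c) ^ d * (j P′ r)
  P′-+-≤ {j} r d j≤c = ≤-trans (m≤m+n (j P′ (r + d)) _) (*-P′-+-≤ r d j≤c)

  -- A linear lower bound on d ↦ (2c)^d · (j P′ (r + 1 ∸ d)), with the term d · (j ∸ r) · (j P′ r)
  -- moved to the right-hand side so that no subtraction occurs.
  P′-tangent : ∀ {j c} r rₓ d → j ≤ c → rₓ + d ≡ suc r →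
    (j ∸ r) * (j P′ r) + d * (2 * c * (j P′ r)) ≤ d * ((j ∸ r) * (j P′ r)) + (2 * c) ^ d * (j P′ rₓ)
  P′-tangent r rₓ zero j≤c rₓ≡1+r rewrite +-identityʳ rₓ | rₓ≡1+r = ≤-refl
  P′-tangent {j} {c} r rₓ (suc d) j≤c rₓ+1+d≡1+r = +-mono-≤ (m≤m+n ((j ∸ r) * (j P′ r)) _) (begin
    suc d * (2 * c * (j P′ r))          ≡⟨ x∙yz≈y∙xz (suc d) (2 * c) (j P′ r) ⟩
    2 * c * (suc d * (j P′ r))          ≡⟨ cong (λ t → 2 * c * (suc d * (j P′ t))) rₓ+d≡r ⟨
    2 * c * (suc d * (j P′ (rₓ + d)))   ≤⟨ *-monoʳ-≤ (2 * c) (*-P′-+-≤ rₓ d j≤c) ⟩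
    2 * c * ((2 * c) ^ d * (j P′ rₓ))   ≡⟨ *-assoc (2 * c) _ (j P′ rₓ) ⟨
    (2 * c) ^ suc d * (j P′ rₓ)         ∎)
    where
    open ≤-Reasoning
    rₓ+d≡r : rₓ + d ≡ r
    rₓ+d≡r = suc-injective (trans (sym (+-suc rₓ d)) rₓ+1+d≡1+r)

  ∑-*-distrib-+ : ∀ {n} (w f g : Fin n → ℕ) →
    ∑[ x < n ] (w x * (f x + g x)) ≡ ∑[ x < n ] (w x * f x) + ∑[ x < n ] (w x * g x)
  ∑-*-distrib-+ w f g = trans (sum-cong-≗ (λ x → *-distribˡ-+ (w x) (f x) (g x)))
                              (∑-distrib-+ (λ x → w x * f x) (λ x → w x * g x))

  ∑-*-*ʳ : ∀ {n} (w f : Fin n → ℕ) c → ∑[ x < n ] (w x * (f x * c)) ≡ ∑[ x < n ] (w x * f x) * c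
  ∑-*-*ʳ w f c = trans (sum-cong-≗ (λ x → sym (*-assoc (w x) (f x) c)))
                       (sym (*-distribʳ-sum c (λ x → w x * f x)))

  ∑-P′-tangent : ∀ {n} (w rₓ dₓ : Fin n → ℕ) r {j c} → j ≤ c → (∀ x → rₓ x + dₓ x ≡ suc r) →
    sum w * ((j ∸ r) * (j P′ r)) + ∑[ x < n ] (w x * dₓ x) * (2 * c * (j P′ r))
      ≤ ∑[ x < n ] (w x * dₓ x) * ((j ∸ r) * (j P′ r)) + ∑[ x < n ] (w x * ((2 * c) ^ dₓ x * (j P′ rₓ x)))
  ∑-P′-tangent {n} w rₓ dₓ r {j} {c} j≤c rₓ+dₓ≡1+r = begin
    sum w * u + S * v                                      ≡⟨ cong₂ _+_ (sym (*-distribʳ-sum u w)) (∑-*-*ʳ w dₓ v) ⟨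
    ∑[ x < n ] (w x * u) + ∑[ x < n ] (w x * (dₓ x * v))   ≡⟨ ∑-*-distrib-+ w (λ _ → u) (λ x → dₓ x * v) ⟨
    ∑[ x < n ] (w x * (u + dₓ x * v))                      ≤⟨ sum-mono-≤ (λ x → *-monoʳ-≤ (w x) (tangent x)) ⟩
    ∑[ x < n ] (w x * (dₓ x * u + φ x))                    ≡⟨ ∑-*-distrib-+ w (λ x → dₓ x * u) φ ⟩
    ∑[ x < n ] (w x * (dₓ x * u)) + ∑[ x < n ] (w x * φ x) ≡⟨ cong (_+ ∑[ x < n ] (w x * φ x)) (∑-*-*ʳ w dₓ u) ⟩
    S * u + ∑[ x < n ] (w x * φ x)                         ∎
    where
    open ≤-Reasoning
    u v S : ℕ
    u = (j ∸ r) * (j P′ r)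
    v = 2 * c * (j P′ r)
    S = ∑[ x < n ] (w x * dₓ x)
    φ : Fin n → ℕ
    φ x = (2 * c) ^ dₓ x * (j P′ rₓ x)
    tangent : ∀ x → u + dₓ x * v ≤ dₓ x * u + φ x
    tangent x = P′-tangent r (rₓ x) (dₓ x) j≤c (rₓ+dₓ≡1+r x)

  P′-averaging : ∀ {n} (w rₓ dₓ : Fin n → ℕ) r {j c} → suc j ≤ c → (∀ x → rₓ x + dₓ x ≡ r) →
    r * sum w ≤ c * ∑[ x < n ] (w x * dₓ x) →
    sum w * (suc j P′ r) ≤ ∑[ x < n ] (w x * ((2 * c) ^ dₓ x * (j P′ rₓ x)))
  P′-averaging {n} w rₓ dₓ zero {j} {c} _ rₓ+dₓ≡0 _ = begin
    sum w * 1                                         ≡⟨ *-distribʳ-sum 1 w ⟩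
    ∑[ x < n ] (w x * 1)                              ≡⟨ sum-cong-≗ (λ x → cong (w x *_) (term x)) ⟨
    ∑[ x < n ] (w x * ((2 * c) ^ dₓ x * (j P′ rₓ x))) ∎
    where
    open ≤-Reasoning
    term : ∀ x → (2 * c) ^ dₓ x * (j P′ rₓ x) ≡ 1
    term x rewrite m+n≡0⇒m≡0 (rₓ x) (rₓ+dₓ≡0 x) | m+n≡0⇒n≡0 (rₓ x) (rₓ+dₓ≡0 x) = refl
  P′-averaging {n} w rₓ dₓ (suc r) {j} {c} 1+j≤c rₓ+dₓ≡r spread = +-cancelʳ-≤ (S * (a * Q)) _ _ (begin
    m * (suc j P′ suc r) + S * (a * Q)          ≡⟨ cong (λ t → m * t + S * (a * Q)) (nP′k≡n[n∸1P′k∸1] (suc j) (suc r)) ⟩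
    m * (suc j * Q) + S * (a * Q)               ≤⟨ +-monoˡ-≤ (S * (a * Q)) (*-monoʳ-≤ m (*-monoˡ-≤ Q 1+j≤a+1+r)) ⟩
    m * ((a + suc r) * Q) + S * (a * Q)         ≡⟨ expand m a (suc r) Q S ⟩
    m * (a * Q) + suc r * m * Q + S * a * Q     ≤⟨ +-mono-≤ (+-monoʳ-≤ (m * (a * Q)) (*-monoˡ-≤ Q spread))
                                                            (*-monoˡ-≤ Q S*a≤c*S) ⟩
    m * (a * Q) + c * S * Q + c * S * Q         ≡⟨ collect m a Q c S ⟩
    m * (a * Q) + S * (2 * c * Q)               ≤⟨ ∑-P′-tangent w rₓ dₓ r j≤c rₓ+dₓ≡r ⟩
    S * (a * Q) + A                             ≡⟨ +-comm (S * (a * Q)) A ⟩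
    A + S * (a * Q)                             ∎)
    where
    open ≤-Reasoning
    m S a Q A : ℕ
    m = sum w
    S = ∑[ x < n ] (w x * dₓ x)
    a = j ∸ r
    Q = j P′ r
    A = ∑[ x < n ] (w x * ((2 * c) ^ dₓ x * (j P′ rₓ x)))
    j≤c : j ≤ c
    j≤c = <⇒≤ 1+j≤c
    S*a≤c*S : S * a ≤ c * S
    S*a≤c*S = ≤-trans (≤-reflexive (*-comm S a)) (*-monoˡ-≤ S (≤-trans (m∸n≤m j r) j≤c))
    1+j≤a+1+r : suc j ≤ a + suc r
    1+j≤a+1+r = subst (suc j ≤_) (sym (+-suc a r)) (s≤s (subst (j ≤_) (+-comm r a) (m≤n+m∸n j r)))
    expand : ∀ m a r Q S → m * ((a + r) * Q) + S * (a * Q) ≡ m * (a * Q) + r * m * Q + S * a * Q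
    expand = solve-∀
    collect : ∀ m a Q c S → m * (a * Q) + c * S * Q + c * S * Q ≡ m * (a * Q) + S * (2 * c * Q)
    collect = solve-∀

  -- A lower bound for the number of uncovered sets

  ∑-∣─∣-swap : ∀ {n K} (U : Fin K → Subset n) R V →
    ∑[ i < K ] (⟦ R i ⟧ * ∣ V ─ U i ∣) ≡ ∑[ x < n ] (⟦ lookup V x ⟧ * ∣ R ∩ᶠ avoiding U x ∣ᶠ)
  ∑-∣─∣-swap {n} {K} U R V = begin
    ∑[ i < K ] (⟦ R i ⟧ * ∣ V ─ U i ∣)   ≡⟨ sum-cong-≗ (λ i → trans (cong (⟦ R i ⟧ *_) (∣p─q∣≡∑ V (U i)))
                                                                (*-distribˡ-sum ⟦ R i ⟧ (λ x → ⟦ V∖U i x ⟧))) ⟩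
    ∑[ i < K ] ∑[ x < n ] h i x          ≡⟨ ∑-comm h ⟩
    ∑[ x < n ] ∑[ i < K ] h i x          ≡⟨ sum-cong-≗ (λ x → trans (sum-cong-≗ (λ i → swap (R i) (lookup V x) (lookup (U i) x)))
                                                                (sym (*-distribˡ-sum ⟦ lookup V x ⟧ (λ i → ⟦ (R ∩ᶠ avoiding U x) i ⟧)))) ⟩
    ∑[ x < n ] (⟦ lookup V x ⟧ * ∣ R ∩ᶠ avoiding U x ∣ᶠ) ∎
    where
    open ≡-Reasoning
    V∖U : Fin K → Fin n → Bool
    V∖U i x = lookup V x ∧ not (lookup (U i) x)
    h : Fin K → Fin n → ℕ
    h i x = ⟦ R i ⟧ * ⟦ V∖U i x ⟧
    swap : ∀ r v u → ⟦ r ⟧ * ⟦ v ∧ not u ⟧ ≡ ⟦ v ⟧ * ⟦ r ∧ not u ⟧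
    swap r v u rewrite ⟦∧⟧ v (not u) | ⟦∧⟧ r (not u) = x∙yz≈y∙xz ⟦ r ⟧ ⟦ v ⟧ ⟦ not u ⟧

  ∣R∣*∣V∣≤c*∑ : ∀ {n K} (U : Fin K → Subset n) R V {c} → (∀ i → R i ≡ true → ∣ V ∣ ≤ c * ∣ V ─ U i ∣) →
    ∣ R ∣ᶠ * ∣ V ∣ ≤ c * ∑[ x < n ] (⟦ lookup V x ⟧ * ∣ R ∩ᶠ avoiding U x ∣ᶠ)
  ∣R∣*∣V∣≤c*∑ {n} {K} U R V {c} V⊈U = begin
    ∣ R ∣ᶠ * ∣ V ∣                           ≡⟨ *-distribʳ-sum ∣ V ∣ (λ i → ⟦ R i ⟧) ⟩
    ∑[ i < K ] (⟦ R i ⟧ * ∣ V ∣)             ≤⟨ sum-mono-≤ term ⟩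
    ∑[ i < K ] (c * (⟦ R i ⟧ * ∣ V ─ U i ∣)) ≡⟨ *-distribˡ-sum c (λ i → ⟦ R i ⟧ * ∣ V ─ U i ∣) ⟨
    c * ∑[ i < K ] (⟦ R i ⟧ * ∣ V ─ U i ∣)   ≡⟨ cong (c *_) (∑-∣─∣-swap U R V) ⟩
    c * ∑[ x < n ] (⟦ lookup V x ⟧ * ∣ R ∩ᶠ avoiding U x ∣ᶠ) ∎
    where
    open ≤-Reasoning
    term : ∀ i → ⟦ R i ⟧ * ∣ V ∣ ≤ c * (⟦ R i ⟧ * ∣ V ─ U i ∣)
    term i with R i in i∈R
    ... | false = z≤n
    ... | true  rewrite +-identityʳ ∣ V ∣ | +-identityʳ ∣ V ─ U i ∣ = V⊈U i i∈R

  ∣V∣*[1+j]P′∣R∣≤∑ : ∀ {n K} (U : Fin K → Subset n) R V {j c} → suc j ≤ c →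
    (∀ i → R i ≡ true → ∣ V ∣ ≤ c * ∣ V ─ U i ∣) →
    ∣ V ∣ * (suc j P′ ∣ R ∣ᶠ)
      ≤ ∑[ x < n ] (⟦ lookup V x ⟧ * ((2 * c) ^ ∣ R ∩ᶠ avoiding U x ∣ᶠ * (j P′ ∣ R ∩ᶠ containing U x ∣ᶠ)))
  ∣V∣*[1+j]P′∣R∣≤∑ {n} U R V {j} {c} 1+j≤c V⊈U =
    subst (λ t → t * (suc j P′ ∣ R ∣ᶠ) ≤ ∑[ x < n ] (w x * ((2 * c) ^ dₓ x * (j P′ rₓ x)))) (sym (∣p∣≡∑ V))
      (P′-averaging w rₓ dₓ ∣ R ∣ᶠ 1+j≤c (λ x → ∣∩ᶠ∣+∣∩ᶠ∁∣ R (containing U x))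
        (subst (λ t → ∣ R ∣ᶠ * t ≤ c * ∑[ x < n ] (w x * dₓ x)) (∣p∣≡∑ V) (∣R∣*∣V∣≤c*∑ U R V {c} V⊈U)))
    where
    w rₓ dₓ : Fin n → ℕ
    w x = ⟦ lookup V x ⟧
    rₓ x = ∣ R ∩ᶠ containing U x ∣ᶠ
    dₓ x = ∣ R ∩ᶠ avoiding U x ∣ᶠ

  #uncovered-step : ∀ {n K} (U : Fin K → Subset n) R V {j c} → suc j ≤ c →
    (∀ i → R i ≡ true → ∣ V ∣ ≤ c * ∣ V ─ U i ∣) →
    (∀ x → lookup V x ≡ true →
       (j P′ ∣ R ∩ᶠ containing U x ∣ᶠ) * (pred ∣ V ∣ C j)
         ≤ (2 * c) ^ ∣ R ∩ᶠ containing U x ∣ᶠ * #uncovered U (R ∩ᶠ containing U x) (V - x) j) →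
    (suc j P′ ∣ R ∣ᶠ) * (∣ V ∣ C suc j) ≤ (2 * c) ^ ∣ R ∣ᶠ * #uncovered U R V (suc j)
  #uncovered-step {n} U R V {j} {c} 1+j≤c V⊈U below = *-cancelˡ-≤ (suc j) (begin
    suc j * ((suc j P′ r) * (∣ V ∣ C suc j))    ≡⟨ x∙yz≈y∙xz (suc j) (suc j P′ r) _ ⟩
    (suc j P′ r) * (suc j * (∣ V ∣ C suc j))    ≡⟨ cong ((suc j P′ r) *_) ([1+k]*nC[1+k]≡n*[n-1]Ck ∣ V ∣ j) ⟩
    (suc j P′ r) * (∣ V ∣ * (m C j))            ≡⟨ reassoc (suc j P′ r) ∣ V ∣ (m C j) ⟩
    ∣ V ∣ * (suc j P′ r) * (m C j)              ≤⟨ *-monoˡ-≤ (m C j) (∣V∣*[1+j]P′∣R∣≤∑ U R V 1+j≤c V⊈U) ⟩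
    ∑[ x < n ] (⟦ lookup V x ⟧ * φ x) * (m C j) ≡⟨ *-distribʳ-sum (m C j) (λ x → ⟦ lookup V x ⟧ * φ x) ⟩
    ∑[ x < n ] (⟦ lookup V x ⟧ * φ x * (m C j)) ≤⟨ sum-mono-≤ term ⟩
    ∑[ x < n ] (D ^ r * (⟦ lookup V x ⟧ * g x)) ≡⟨ *-distribˡ-sum (D ^ r) (λ x → ⟦ lookup V x ⟧ * g x) ⟨
    D ^ r * ∑[ x < n ] (⟦ lookup V x ⟧ * g x)   ≡⟨ cong (D ^ r *_) (#uncovered-double-count U R V j) ⟨
    D ^ r * (suc j * #uncovered U R V (suc j))  ≡⟨ x∙yz≈y∙xz (D ^ r) (suc j) _ ⟩
    suc j * (D ^ r * #uncovered U R V (suc j))  ∎)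
    where
    open ≤-Reasoning
    D r m : ℕ
    D = 2 * c
    r = ∣ R ∣ᶠ
    m = pred ∣ V ∣
    rₓ dₓ φ g : Fin n → ℕ
    rₓ x = ∣ R ∩ᶠ containing U x ∣ᶠ
    dₓ x = ∣ R ∩ᶠ avoiding U x ∣ᶠ
    φ x = D ^ dₓ x * (j P′ rₓ x)
    g x = #uncovered U (R ∩ᶠ containing U x) (V - x) j
    rₓ+dₓ≡r : ∀ x → rₓ x + dₓ x ≡ r
    rₓ+dₓ≡r x = ∣∩ᶠ∣+∣∩ᶠ∁∣ R (containing U x)
    reassoc : ∀ a b c → a * (b * c) ≡ b * a * c
    reassoc = solve-∀
    term : ∀ x → ⟦ lookup V x ⟧ * φ x * (m C j) ≤ D ^ r * (⟦ lookup V x ⟧ * g x)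
    term x with lookup V x in x∈V
    ... | false = z≤n
    ... | true  rewrite +-identityʳ (φ x) | +-identityʳ (g x) = begin
      D ^ dₓ x * (j P′ rₓ x) * (m C j)     ≡⟨ *-assoc (D ^ dₓ x) (j P′ rₓ x) (m C j) ⟩
      D ^ dₓ x * ((j P′ rₓ x) * (m C j))   ≤⟨ *-monoʳ-≤ (D ^ dₓ x) (below x x∈V) ⟩
      D ^ dₓ x * (D ^ rₓ x * g x)          ≡⟨ *-assoc (D ^ dₓ x) (D ^ rₓ x) (g x) ⟨
      D ^ dₓ x * D ^ rₓ x * g x            ≡⟨ cong (_* g x) (^-distribˡ-+-* D (dₓ x) (rₓ x)) ⟨
      D ^ (dₓ x + rₓ x) * g x              ≡⟨ cong (λ t → D ^ t * g x) (trans (+-comm (dₓ x) (rₓ x)) (rₓ+dₓ≡r x)) ⟩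
      D ^ r * g x                          ∎

  #uncovered-lower-bound : ∀ {n K} (U : Fin K → Subset n) {c} j → j ≤ c → ∀ V R →
    (∀ i → R i ≡ true → ∣ V ∣ ≤ c * ∣ V ─ U i ∣) →
    (j P′ ∣ R ∣ᶠ) * (∣ V ∣ C j) ≤ (2 * c) ^ ∣ R ∣ᶠ * #uncovered U R V j
  #uncovered-lower-bound {n} U zero _ V R _ with ∣ R ∣ᶠ in ∣R∣≡0
  ... | suc r rewrite 0∸n≡0 r = z≤n
  ... | zero  = *-monoʳ-≤ 1 (subst (_≤ #uncovered U R V 0) ⊥-uncovered (f≤∑ₛf (λ T → ⟦ uncovered U R V 0 T ⟧) ⊥))
    where
    R∧⊥⊆U≡false : ∀ i → (R i ∧ (⊥ ⊆ᵇ U i)) ≡ false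
    R∧⊥⊆U≡false i = cong (_∧ (⊥ ⊆ᵇ U i)) (∣R∣ᶠ≡0⇒R≗false R ∣R∣≡0 i)
    ⊥-uncovered : ⟦ uncovered U R V 0 ⊥ ⟧ ≡ 1
    ⊥-uncovered rewrite ⊥⊆ᵇp V | ∣⊥∣≡0 n | anyᵇ-false (λ i → R i ∧ (⊥ ⊆ᵇ U i)) R∧⊥⊆U≡false = refl
  #uncovered-lower-bound U {c} (suc j) 1+j≤c V R V⊈U = #uncovered-step U R V 1+j≤c V⊈U λ x x∈V →
    subst (λ t → (j P′ ∣ Rₓ x ∣ᶠ) * (t C j) ≤ (2 * c) ^ ∣ Rₓ x ∣ᶠ * #uncovered U (Rₓ x) (V - x) j)
          (cong pred (suc∣p-x∣ V x x∈V))
          (#uncovered-lower-bound U j (<⇒≤ 1+j≤c) (V - x) (Rₓ x) (V-x⊈U x))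
    where
    Rₓ : _ → _ → Bool
    Rₓ x = R ∩ᶠ containing U x
    V-x⊈U : ∀ x i → Rₓ x i ≡ true → ∣ V - x ∣ ≤ c * ∣ V - x ─ U i ∣
    V-x⊈U x i i∈Rₓ = ∣p-x∣≤c*∣p-x─q∣ {c = c} V (U i) x (∧-conicalʳ (R i) _ i∈Rₓ) (V⊈U i (∧-conicalˡ (R i) _ i∈Rₓ))

  -- Factorial estimates

  ^-distribʳ-* : ∀ a b m → (a * b) ^ m ≡ a ^ m * b ^ m
  ^-distribʳ-* a b zero    = refl
  ^-distribʳ-* a b (suc m) =
    trans (cong ((a * b) *_) (^-distribʳ-* a b m)) (interchange a b (a ^ m) (b ^ m))
    where
    interchange : ∀ a b x y → a * b * (x * y) ≡ a * x * (b * y)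
    interchange = solve-∀

  bernoulli : ∀ N i → suc N ^ i * (N ∸ i) ≤ N ^ suc i
  bernoulli N zero    = ≤-reflexive (*-comm 1 N)
  bernoulli N (suc i) = begin
    suc N ^ suc i * (N ∸ suc i)         ≡⟨ reassoc (suc N) (suc N ^ i) (N ∸ suc i) ⟩
    suc N ^ i * (suc N * (N ∸ suc i))   ≡⟨ cong (λ t → suc N ^ i * (suc N * t)) (pred[m∸n]≡m∸[1+n] N i) ⟨
    suc N ^ i * (suc N * pred (N ∸ i))  ≤⟨ *-monoʳ-≤ (suc N ^ i) (step (N ∸ i) (m∸n≤m N i)) ⟩
    suc N ^ i * (N * (N ∸ i))           ≡⟨ x∙yz≈y∙xz (suc N ^ i) N (N ∸ i) ⟩
    N * (suc N ^ i * (N ∸ i))           ≤⟨ *-monoʳ-≤ N (bernoulli N i) ⟩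
    N * N ^ suc i                       ∎
    where
    open ≤-Reasoning
    reassoc : ∀ a b c → a * b * c ≡ b * (a * c)
    reassoc = solve-∀
    step : ∀ t → t ≤ N → suc N * pred t ≤ N * t
    step zero    _   = ≤-refl
    step (suc t) t<N = subst (suc N * t ≤_) (sym (*-suc N t)) (+-monoˡ-≤ (N * t) (<⇒≤ t<N))

  [1+2m]^m≤2*[2m]^m : ∀ m → suc (2 * m) ^ m ≤ 2 * (2 * m) ^ m
  [1+2m]^m≤2*[2m]^m zero        = s≤s z≤n
  [1+2m]^m≤2*[2m]^m m@(suc _) = *-cancelʳ-≤ _ _ m (begin
    suc (2 * m) ^ m * m             ≡⟨ cong (suc (2 * m) ^ m *_) (sym (m+n∸n≡m m m)) ⟩
    suc (2 * m) ^ m * (m + m ∸ m)   ≡⟨ cong (λ t → suc (2 * m) ^ m * (m + t ∸ m)) (+-identityʳ m) ⟨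
    suc (2 * m) ^ m * (2 * m ∸ m)   ≤⟨ bernoulli (2 * m) m ⟩
    (2 * m) ^ suc m                 ≡⟨ reassoc m ((2 * m) ^ m) ⟩
    2 * (2 * m) ^ m * m             ∎)
    where
    open ≤-Reasoning
    reassoc : ∀ m X → 2 * m * X ≡ 2 * X * m
    reassoc = solve-∀

  [1+m]^m≤4*m^m : ∀ m → suc m ^ m ≤ 4 * m ^ m
  [1+m]^m≤4*m^m zero        = s≤s z≤n
  [1+m]^m≤4*m^m m@(suc _) = *-cancelˡ-≤ ((4 * m) ^ m) {{m^n≢0 (4 * m) m}} (begin
    (4 * m) ^ m * suc m ^ m                   ≡⟨ ^-distribʳ-* (4 * m) (suc m) m ⟨
    (4 * m * suc m) ^ m                       ≤⟨ ^-monoˡ-≤ m (≤-trans (n≤1+n _) (≤-reflexive (square m))) ⟩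
    (suc (2 * m) * suc (2 * m)) ^ m           ≡⟨ ^-distribʳ-* (suc (2 * m)) (suc (2 * m)) m ⟩
    suc (2 * m) ^ m * suc (2 * m) ^ m         ≤⟨ *-mono-≤ ([1+2m]^m≤2*[2m]^m m) ([1+2m]^m≤2*[2m]^m m) ⟩
    2 * (2 * m) ^ m * (2 * (2 * m) ^ m)       ≡⟨ cong₂ (λ x y → 2 * x * (2 * y)) (^-distribʳ-* 2 m m) (^-distribʳ-* 2 m m) ⟩
    2 * (2 ^ m * m ^ m) * (2 * (2 ^ m * m ^ m)) ≡⟨ regroup (2 ^ m) (m ^ m) ⟩
    (2 ^ m * 2 ^ m) * (4 * m ^ m) * m ^ m     ≡⟨ cong (λ t → t * (4 * m ^ m) * m ^ m) (^-distribʳ-* 2 2 m) ⟨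
    4 ^ m * (4 * m ^ m) * m ^ m               ≡⟨ reassoc (4 ^ m) (m ^ m) ⟩
    4 ^ m * m ^ m * (4 * m ^ m)               ≡⟨ cong (_* (4 * m ^ m)) (^-distribʳ-* 4 m m) ⟨
    (4 * m) ^ m * (4 * m ^ m)                 ∎)
    where
    open ≤-Reasoning
    square : ∀ m → suc (4 * m * suc m) ≡ suc (2 * m) * suc (2 * m)
    square = solve-∀
    regroup : ∀ a b → 2 * (a * b) * (2 * (a * b)) ≡ (a * a) * (4 * b) * b
    regroup = solve-∀
    reassoc : ∀ a b → a * (4 * b) * b ≡ a * b * (4 * b)
    reassoc = solve-∀

  m^m≤4^m*m! : ∀ m → m ^ m ≤ 4 ^ m * m !
  m^m≤4^m*m! zero    = ≤-refl
  m^m≤4^m*m! (suc m) = begin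
    suc m * suc m ^ m            ≤⟨ *-monoʳ-≤ (suc m) ([1+m]^m≤4*m^m m) ⟩
    suc m * (4 * m ^ m)          ≤⟨ *-monoʳ-≤ (suc m) (*-monoʳ-≤ 4 (m^m≤4^m*m! m)) ⟩
    suc m * (4 * (4 ^ m * m !))  ≡⟨ reassoc (suc m) (4 ^ m) (m !) ⟩
    4 * 4 ^ m * (suc m * m !)    ∎
    where
    open ≤-Reasoning
    reassoc : ∀ a b c → a * (4 * (b * c)) ≡ 4 * b * (a * c)
    reassoc = solve-∀

  [2+m]^m≤16*m^m : ∀ m → (2 + m) ^ m ≤ 16 * m ^ m
  [2+m]^m≤16*m^m zero        = s≤s z≤n
  [2+m]^m≤16*m^m m@(suc _) = *-cancelˡ-≤ (m ^ m) {{m^n≢0 m m}} (begin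
    m ^ m * (2 + m) ^ m          ≡⟨ ^-distribʳ-* m (2 + m) m ⟨
    (m * (2 + m)) ^ m            ≤⟨ ^-monoˡ-≤ m (≤-trans (n≤1+n _) (≤-reflexive (square m))) ⟩
    (suc m * suc m) ^ m          ≡⟨ ^-distribʳ-* (suc m) (suc m) m ⟩
    suc m ^ m * suc m ^ m        ≤⟨ *-mono-≤ ([1+m]^m≤4*m^m m) ([1+m]^m≤4*m^m m) ⟩
    4 * m ^ m * (4 * m ^ m)      ≡⟨ reassoc (m ^ m) ⟩
    m ^ m * (16 * m ^ m)         ∎)
    where
    open ≤-Reasoning
    square : ∀ m → suc (m * (2 + m)) ≡ suc m * suc m
    square = solve-∀
    reassoc : ∀ a → 4 * a * (4 * a) ≡ a * (16 * a)
    reassoc = solve-∀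

  [2[2+m]]^m≤16^[1+m]*m! : ∀ m → (2 * (2 + m)) ^ m ≤ 16 ^ suc m * m !
  [2[2+m]]^m≤16^[1+m]*m! m = begin
    (2 * (2 + m)) ^ m           ≡⟨ ^-distribʳ-* 2 (2 + m) m ⟩
    2 ^ m * (2 + m) ^ m         ≤⟨ *-monoʳ-≤ (2 ^ m) (≤-trans ([2+m]^m≤16*m^m m) (*-monoʳ-≤ 16 (m^m≤4^m*m! m))) ⟩
    2 ^ m * (16 * (4 ^ m * m !)) ≡⟨ reassoc (2 ^ m) (4 ^ m) (m !) ⟩
    16 * ((2 ^ m * 4 ^ m) * m !) ≡⟨ cong (λ t → 16 * (t * m !)) (^-distribʳ-* 2 4 m) ⟨
    16 * (8 ^ m * m !)           ≤⟨ *-monoʳ-≤ 16 (*-monoˡ-≤ (m !) (^-monoˡ-≤ m (m≤m+n 8 8))) ⟩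
    16 * (16 ^ m * m !)          ≡⟨ *-assoc 16 (16 ^ m) (m !) ⟨
    16 ^ suc m * m !             ∎
    where
    open ≤-Reasoning
    reassoc : ∀ a b c → a * (16 * (b * c)) ≡ 16 * ((a * b) * c)
    reassoc = solve-∀

  -- Cores of an edge-coloured hypergraph

  ⊆-⋃ : ∀ {n} {p : Subset n} {ps} → p ∈ ps → p ⊆ List.foldr _∪_ ⊥ ps
  ⊆-⋃ {p = p} (here refl) = p⊆p∪q _
  ⊆-⋃ {ps = q ∷ _} (there p∈ps) = ⊆-trans (⊆-⋃ p∈ps) (q⊆p∪q q _)

  edge⊆monoCore : ∀ {n c} (colour : Subset n → Fin c) {edges e} → e ∈ edges → e ⊆ monoCore colour edges (colour e)
  edge⊆monoCore colour e∈edges = ⊆-⋃ (∈-filter⁺ (λ e′ → colour e′ ≟ᶠ colour _) e∈edges refl)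

  edges+#uncovered≤nCk : ∀ {n K} (colour : Subset n → Fin K) (edges : List (Subset n)) k →
    Unique edges → All (λ e → ∣ e ∣ ≡ k) edges →
    length edges + #uncovered (monoCore colour edges) ⊤ᶠ ⊤ k ≤ n C k
  edges+#uncovered≤nCk {n} colour edges k unique sizes = begin
    length edges + #uncovered U ⊤ᶠ ⊤ k                        ≤⟨ +-monoˡ-≤ (#uncovered U ⊤ᶠ ⊤ k)
                                                                   (length≤∑ₛ covered edges unique (All.tabulate covers)) ⟩
    ∑ₛ (λ T → ⟦ covered T ⟧) + #uncovered U ⊤ᶠ ⊤ k            ≡⟨ ∑ₛ-distrib-+ (λ T → ⟦ covered T ⟧) (λ T → ⟦ uncovered U ⊤ᶠ ⊤ k T ⟧) ⟨
    ∑ₛ (λ T → ⟦ covered T ⟧ + ⟦ uncovered U ⊤ᶠ ⊤ k T ⟧)       ≡⟨ ∑ₛ-cong split ⟩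
    ∑ₛ {n} (λ T → ⟦ ∣ T ∣ ≡ᵇ k ⟧)                              ≡⟨ ∑ₛ-size≡C n k ⟩
    n C k                                                      ∎
    where
    open ≤-Reasoning
    U = monoCore colour edges
    covered : Subset n → Bool
    covered T = (∣ T ∣ ≡ᵇ k) ∧ coveredBy U ⊤ᶠ T
    split : ∀ T → ⟦ covered T ⟧ + ⟦ uncovered U ⊤ᶠ ⊤ k T ⟧ ≡ ⟦ ∣ T ∣ ≡ᵇ k ⟧
    split T rewrite p⊆ᵇ⊤ T = sym (⟦⟧-split (∣ T ∣ ≡ᵇ k) (coveredBy U ⊤ᶠ T))
    covers : ∀ {e} → e ∈ edges → covered e ≡ true
    covers {e} e∈edges
      rewrite Equivalence.to T-≡ (≡⇒≡ᵇ _ _ (All.lookup sizes e∈edges)) =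
        anyᵇ-true (λ i → e ⊆ᵇ U i) (colour e) (⊆⇒⊆ᵇ (edge⊆monoCore colour e∈edges))

  module _ {n K} (U : Fin K → Subset n) where

    degree : Fin n → ℕ
    degree x = ∣ containing U x ∣ᶠ

    #lowDegree : ℕ → ℕ
    #lowDegree k = ∑[ x < n ] ⟦ degree x <ᵇ k ⟧

    k*n≤k*#lowDegree+∑∣U∣ : ∀ k → k * n ≤ k * #lowDegree k + ∑[ i < K ] ∣ U i ∣
    k*n≤k*#lowDegree+∑∣U∣ k = begin
      k * n                                                ≡⟨ trans (*-comm k n) (sym (sum-const n k)) ⟩
      ∑[ x < n ] k                                         ≤⟨ sum-mono-≤ term ⟩
      ∑[ x < n ] (k * ⟦ low x ⟧ + degree x)                ≡⟨ ∑-distrib-+ (λ x → k * ⟦ low x ⟧) degree ⟩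
      ∑[ x < n ] (k * ⟦ low x ⟧) + ∑[ x < n ] degree x     ≡⟨ cong₂ _+_ (*-distribˡ-sum k (λ x → ⟦ low x ⟧)) ∑∣U∣≡∑degree ⟨
      k * #lowDegree k + ∑[ i < K ] ∣ U i ∣                ∎
      where
      open ≤-Reasoning
      low : Fin n → Bool
      low x = degree x <ᵇ k
      term : ∀ x → k ≤ k * ⟦ low x ⟧ + degree x
      term x with degree x <ᵇ k | <ᵇ-reflects-< (degree x) k
      ... | true  | _         = ≤-trans (≤-reflexive (sym (*-identityʳ k))) (m≤m+n (k * 1) (degree x))
      ... | false | ofⁿ dₓ≮k = ≤-trans (≮⇒≥ dₓ≮k) (m≤n+m (degree x) (k * 0))
      ∑∣U∣≡∑degree : ∑[ i < K ] ∣ U i ∣ ≡ ∑[ x < n ] degree x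
      ∑∣U∣≡∑degree = trans (sum-cong-≗ (λ i → ∣p∣≡∑ (U i))) (∑-comm (λ i x → ⟦ lookup (U i) x ⟧))

    #lowDegree-bound : ∀ j {c} → j ≤ c → (∀ i → n ≤ c * ∣ ⊤ ─ U i ∣) →
      #lowDegree (suc j) * ((j P′ j) * (pred n C j)) ≤ (2 * c) ^ j * (suc j * #uncovered U ⊤ᶠ ⊤ (suc j))
    #lowDegree-bound j {c} j≤c n≤c*∣⊤─U∣ = begin
      #lowDegree (suc j) * B                      ≡⟨ *-distribʳ-sum B (λ x → ⟦ low x ⟧) ⟩
      ∑[ x < n ] (⟦ low x ⟧ * B)                  ≤⟨ sum-mono-≤ term ⟩
      ∑[ x < n ] (D ^ j * (⟦ lookup ⊤ x ⟧ * g x)) ≡⟨ *-distribˡ-sum (D ^ j) (λ x → ⟦ lookup ⊤ x ⟧ * g x) ⟨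
      D ^ j * ∑[ x < n ] (⟦ lookup ⊤ x ⟧ * g x)   ≡⟨ cong (D ^ j *_) (#uncovered-double-count U ⊤ᶠ ⊤ j) ⟨
      D ^ j * (suc j * #uncovered U ⊤ᶠ ⊤ (suc j)) ∎
      where
      open ≤-Reasoning
      D B : ℕ
      D = 2 * c
      B = (j P′ j) * (pred n C j)
      low : Fin n → Bool
      low x = degree x <ᵇ suc j
      g : Fin n → ℕ
      g x = #uncovered U (containing U x) (⊤ - x) j
      vertex : ∀ x → degree x ≤ j → B ≤ D ^ j * g x
      vertex x deg≤j = begin
        (j P′ j) * (pred n C j)                ≡⟨ cong (λ t → (j P′ t) * (pred n C j)) (m+[n∸m]≡n deg≤j) ⟨
        (j P′ (r + e)) * (pred n C j)          ≤⟨ *-monoˡ-≤ (pred n C j) (P′-+-≤ r e j≤c) ⟩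
        D ^ e * (j P′ r) * (pred n C j)        ≡⟨ *-assoc (D ^ e) (j P′ r) (pred n C j) ⟩
        D ^ e * ((j P′ r) * (pred n C j))      ≡⟨ cong (λ t → D ^ e * ((j P′ r) * (t C j))) ∣⊤-x∣≡n-1 ⟨
        D ^ e * ((j P′ r) * (∣ ⊤ - x ∣ C j))   ≤⟨ *-monoʳ-≤ (D ^ e) (#uncovered-lower-bound U j j≤c (⊤ - x) _ ⊤-x⊈U) ⟩
        D ^ e * (D ^ r * g x)                  ≡⟨ *-assoc (D ^ e) (D ^ r) (g x) ⟨
        D ^ e * D ^ r * g x                    ≡⟨ cong (_* g x) D^e*D^r≡D^j ⟩
        D ^ j * g x                            ∎
        where
        r e : ℕ
        r = degree x
        e = j ∸ r
        D^e*D^r≡D^j : D ^ e * D ^ r ≡ D ^ j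
        D^e*D^r≡D^j = trans (sym (^-distribˡ-+-* D e r)) (cong (D ^_) (m∸n+n≡m deg≤j))
        ∣⊤-x∣≡n-1 : ∣ ⊤ - x ∣ ≡ pred n
        ∣⊤-x∣≡n-1 = cong pred (trans (suc∣p-x∣ ⊤ x (lookup-replicate x true)) (∣⊤∣≡n n))
        ⊤-x⊈U : ∀ i → containing U x i ≡ true → ∣ ⊤ - x ∣ ≤ c * ∣ ⊤ - x ─ U i ∣
        ⊤-x⊈U i x∈Uᵢ =
          ∣p-x∣≤c*∣p-x─q∣ {c = c} ⊤ (U i) x x∈Uᵢ (subst (_≤ c * ∣ ⊤ ─ U i ∣) (sym (∣⊤∣≡n n)) (n≤c*∣⊤─U∣ i))
      term : ∀ x → ⟦ low x ⟧ * B ≤ D ^ j * (⟦ lookup ⊤ x ⟧ * g x)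
      term x with degree x <ᵇ suc j | <ᵇ-reflects-< (degree x) (suc j)
      ... | false | _           = z≤n
      ... | true  | ofʸ deg<1+j rewrite lookup-replicate {n = n} x true | +-identityʳ B | +-identityʳ (g x) =
        vertex x (s≤s⁻¹ deg<1+j)

  n≤[1+k]*∣⊤─p∣ : ∀ {n K} k (p : Subset n) → suc k ≤ K → K * ∣ p ∣ < k * n → n ≤ suc k * ∣ ⊤ ─ p ∣
  n≤[1+k]*∣⊤─p∣ {n} {K} k p 1+k≤K K∣p∣<kn = begin
    n                    ≡⟨ ∣p∣+∣⊤─p∣≡n p ⟨
    ∣ p ∣ + w            ≤⟨ +-monoˡ-≤ w (<⇒≤ ∣p∣<kw) ⟩
    k * w + w            ≡⟨ +-comm (k * w) w ⟩
    suc k * w            ∎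
    where
    open ≤-Reasoning
    w = ∣ ⊤ ─ p ∣
    ∣p∣<kw : ∣ p ∣ < k * w
    ∣p∣<kw = +-cancelˡ-< (k * ∣ p ∣) _ _ (begin-strict
      k * ∣ p ∣ + ∣ p ∣  ≡⟨ +-comm (k * ∣ p ∣) ∣ p ∣ ⟩
      suc k * ∣ p ∣      ≤⟨ *-monoˡ-≤ ∣ p ∣ 1+k≤K ⟩
      K * ∣ p ∣          <⟨ K∣p∣<kn ⟩
      k * n              ≡⟨ cong (k *_) (∣p∣+∣⊤─p∣≡n p) ⟨
      k * (∣ p ∣ + w)    ≡⟨ *-distribˡ-+ k ∣ p ∣ w ⟩
      k * ∣ p ∣ + k * w  ∎)

  largest : ∀ {n K} → (Fin (suc K) → Subset n) → Fin (suc K)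
  largest U = argmax (λ i → ∣ U i ∣) zero (allFin _)

  ∣U∣≤∣U[largest]∣ : ∀ {n K} (U : Fin (suc K) → Subset n) i → ∣ U i ∣ ≤ ∣ U (largest U) ∣
  ∣U∣≤∣U[largest]∣ U i = All.lookup (f[xs]≤f[argmax] {f = λ i → ∣ U i ∣} zero (allFin _)) (∈-allFin i)

  k*n≤K*#lowDegree+K*∣U[largest]∣ : ∀ {n K} (U : Fin (suc K) → Subset n) k → k ≤ suc K →
    k * n ≤ suc K * #lowDegree U k + suc K * ∣ U (largest U) ∣
  k*n≤K*#lowDegree+K*∣U[largest]∣ {n} {K} U k k≤K = begin
    k * n                                                   ≤⟨ k*n≤k*#lowDegree+∑∣U∣ U k ⟩
    k * #lowDegree U k + ∑[ i < suc K ] ∣ U i ∣              ≤⟨ +-mono-≤ (*-monoˡ-≤ (#lowDegree U k) k≤K) (sum-mono-≤ (∣U∣≤∣U[largest]∣ U)) ⟩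
    suc K * #lowDegree U k + ∑[ i < suc K ] ∣ U (largest U) ∣ ≡⟨ cong (suc K * #lowDegree U k +_) (sum-const (suc K) ∣ U (largest U) ∣) ⟩
    suc K * #lowDegree U k + suc K * ∣ U (largest U) ∣        ∎
    where open ≤-Reasoning

  #lowDegree*F*C≤n*D*#uncovered : ∀ {n K} (U : Fin K → Subset n) j →
    (∀ i → n ≤ (2 + j) * ∣ ⊤ ─ U i ∣) →
    #lowDegree U (suc j) * (j P′ j) * (n C suc j) ≤ n * (2 * (2 + j)) ^ j * #uncovered U ⊤ᶠ ⊤ (suc j)
  #lowDegree*F*C≤n*D*#uncovered {n} U j n≤c*∣⊤─U∣ = *-cancelˡ-≤ (suc j) (begin
    suc j * (s * F * (n C suc j))      ≡⟨ x∙yz≈y∙xz (suc j) (s * F) _ ⟩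
    s * F * (suc j * (n C suc j))      ≡⟨ cong (s * F *_) ([1+k]*nC[1+k]≡n*[n-1]Ck n j) ⟩
    s * F * (n * (pred n C j))         ≡⟨ regroup s F n (pred n C j) ⟩
    n * (s * (F * (pred n C j)))       ≤⟨ *-monoʳ-≤ n (#lowDegree-bound U j j≤2+j n≤c*∣⊤─U∣) ⟩
    n * (D * (suc j * g))              ≡⟨ regroup′ n D (suc j) g ⟩
    suc j * (n * D * g)                ∎)
    where
    open ≤-Reasoning
    s F D g : ℕ
    s = #lowDegree U (suc j)
    F = j P′ j
    D = (2 * (2 + j)) ^ j
    g = #uncovered U ⊤ᶠ ⊤ (suc j)
    j≤2+j : j ≤ 2 + j
    j≤2+j = m≤n+m j 2
    regroup : ∀ s F n C → s * F * (n * C) ≡ n * (s * (F * C))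
    regroup = solve-∀
    regroup′ : ∀ n D k g → n * (D * (k * g)) ≡ k * (n * D * g)
    regroup′ = solve-∀

  D²≤256^[1+j]*F² : ∀ j → (2 * (2 + j)) ^ j * (2 * (2 + j)) ^ j ≤ 256 ^ suc j * ((j P′ j) * (j P′ j))
  D²≤256^[1+j]*F² j = begin
    D * D                                             ≤⟨ *-mono-≤ ([2[2+m]]^m≤16^[1+m]*m! j) ([2[2+m]]^m≤16^[1+m]*m! j) ⟩
    16 ^ suc j * j ! * (16 ^ suc j * j !)             ≡⟨ interchange (16 ^ suc j) (j !) ⟩
    16 ^ suc j * 16 ^ suc j * (j ! * j !)             ≡⟨ cong₂ (λ a b → a * (b * b)) (^-distribʳ-* 16 16 (suc j)) (nP′n≡n! j) ⟨
    256 ^ suc j * ((j P′ j) * (j P′ j))               ∎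
    where
    open ≤-Reasoning
    D = (2 * (2 + j)) ^ j
    interchange : ∀ a b → a * b * (a * b) ≡ a * a * (b * b)
    interchange = solve-∀

module Rationals where

  open import Data.Nat as ℕ using (ℕ; zero; suc)
  import Data.Nat.Properties as ℕ
  open import Data.Integer using (+_)
  import Data.Integer.Properties as ℤ
  open import Data.Nat.Coprimality using (1-coprimeTo; sym)
  open import Data.Rational
  open import Data.Rational.Properties
  import Data.Rational.Unnormalised as ℚᵘ
  import Data.Rational.Unnormalised.Properties as ℚᵘ
  open import Data.Rational.Solver using (module +-*-Solver)
  open import Data.Empty using (⊥-elim)
  open import Relation.Binary.PropositionalEquality hiding (sym)
  import Relation.Binary.PropositionalEquality as ≡
  open import Defs using (ℕ→ℚ; frac)
  open +-*-Solver

  ℕ→ℚ≡mkℚ : ∀ n → ℕ→ℚ n ≡ mkℚ (+ n) 0 (sym (1-coprimeTo n))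
  ℕ→ℚ≡mkℚ n = normalize-coprime (sym (1-coprimeTo n))

  ℕ→ℚ-+ : ∀ a b → ℕ→ℚ (a ℕ.+ b) ≡ ℕ→ℚ a + ℕ→ℚ b
  ℕ→ℚ-+ a b rewrite ℕ→ℚ≡mkℚ a | ℕ→ℚ≡mkℚ b =
    /-cong (trans (ℤ.pos-+ a b) (cong₂ Data.Integer._+_ (≡.sym (ℤ.*-identityʳ (+ a))) (≡.sym (ℤ.*-identityʳ (+ b))))) refl

  ℕ→ℚ-* : ∀ a b → ℕ→ℚ (a ℕ.* b) ≡ ℕ→ℚ a * ℕ→ℚ b
  ℕ→ℚ-* a b rewrite ℕ→ℚ≡mkℚ a | ℕ→ℚ≡mkℚ b = /-cong (ℤ.pos-* a b) refl

  ℕ→ℚ-mono-≤ : ∀ {a b} → a ℕ.≤ b → ℕ→ℚ a ≤ ℕ→ℚ b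
  ℕ→ℚ-mono-≤ {a} {b} a≤b rewrite ℕ→ℚ≡mkℚ a | ℕ→ℚ≡mkℚ b =
    *≤* (subst₂ Data.Integer._≤_ (≡.sym (ℤ.*-identityʳ (+ a))) (≡.sym (ℤ.*-identityʳ (+ b))) (Data.Integer.+≤+ a≤b))

  ℕ→ℚ-nonNeg : ∀ n → NonNegative (ℕ→ℚ n)
  ℕ→ℚ-nonNeg n = nonNegative (ℕ→ℚ-mono-≤ (ℕ.z≤n {n}))

  ℕ→ℚ-mono-< : ∀ {a b} → a ℕ.< b → ℕ→ℚ a < ℕ→ℚ b
  ℕ→ℚ-mono-< {a} {b} a<b rewrite ℕ→ℚ≡mkℚ a | ℕ→ℚ≡mkℚ b =
    *<* (subst₂ Data.Integer._<_ (≡.sym (ℤ.*-identityʳ (+ a))) (≡.sym (ℤ.*-identityʳ (+ b))) (Data.Integer.+<+ a<b))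

  ℕ→ℚ-pos : ∀ {n} → 0 ℕ.< n → Positive (ℕ→ℚ n)
  ℕ→ℚ-pos 0<n = positive (ℕ→ℚ-mono-< 0<n)

  frac-* : ∀ k b → frac k (suc b) * ℕ→ℚ (suc b) ≡ ℕ→ℚ k
  frac-* k b = toℚᵘ-injective (ℚᵘ.≃-trans (toℚᵘ-homo-* (frac k (suc b)) (ℕ→ℚ (suc b)))
    (ℚᵘ.≃-trans (ℚᵘ.*-cong (toℚᵘ-fromℚᵘ (ℚᵘ.mkℚᵘ (+ k) b)) (toℚᵘ-fromℚᵘ (ℚᵘ.mkℚᵘ (+ suc b) 0)))
    (ℚᵘ.≃-trans (ℚᵘ.*≡* cross) (ℚᵘ.≃-sym (toℚᵘ-fromℚᵘ (ℚᵘ.mkℚᵘ (+ k) 0))))))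
    where
    cross : (+ k Data.Integer.* + suc b) Data.Integer.* + 1 ≡ + k Data.Integer.* + (suc b ℕ.* 1)
    cross rewrite ℤ.*-identityʳ (+ k Data.Integer.* + suc b) | ℕ.*-identityʳ (suc b) = refl

  x≤z+y⇒x-y≤z : ∀ x y z → x ≤ z + y → x - y ≤ z
  x≤z+y⇒x-y≤z x y z x≤z+y = subst (x - y ≤_) (cancel z y) (+-monoˡ-≤ (- y) x≤z+y)
    where
    cancel : ∀ z y → z + y - y ≡ z
    cancel = solve 2 (λ z y → z :+ y :- y := z) refl

  y≤x⇒0≤x-y : ∀ x y → y ≤ x → 0ℚ ≤ x - y
  y≤x⇒0≤x-y x y y≤x = subst (_≤ x - y) (+-inverseʳ y) (+-monoˡ-≤ (- y) y≤x)

  -- The quantity d of the statement for a core of size u, with K = suc b colours.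
  deficit : ℕ → ℕ → ℕ → ℕ → ℚ
  deficit k b n u = frac k (suc b) * ℕ→ℚ n - ℕ→ℚ u

  K*deficit : ∀ k b n u → ℕ→ℚ (suc b) * deficit k b n u ≡ ℕ→ℚ (k ℕ.* n) - ℕ→ℚ (suc b ℕ.* u)
  K*deficit k b n u = begin
    K * (frac k (suc b) * ℕ→ℚ n - ℕ→ℚ u)        ≡⟨ distribute K (frac k (suc b)) (ℕ→ℚ n) (ℕ→ℚ u) ⟩
    frac k (suc b) * K * ℕ→ℚ n - K * ℕ→ℚ u      ≡⟨ cong (λ t → t * ℕ→ℚ n - K * ℕ→ℚ u) (frac-* k b) ⟩
    ℕ→ℚ k * ℕ→ℚ n - K * ℕ→ℚ u                  ≡⟨ cong₂ _-_ (ℕ→ℚ-* k n) (ℕ→ℚ-* (suc b) u) ⟨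
    ℕ→ℚ (k ℕ.* n) - ℕ→ℚ (suc b ℕ.* u)          ∎
    where
    open ≡-Reasoning
    K = ℕ→ℚ (suc b)
    distribute : ∀ K q n u → K * (q * n - u) ≡ q * K * n - K * u
    distribute = solve 4 (λ K q n u → K :* (q :* n :- u) := q :* K :* n :- K :* u) refl

  deficit≤ : ∀ k b n u s → k ℕ.* n ℕ.≤ suc b ℕ.* s ℕ.+ suc b ℕ.* u → deficit k b n u ≤ ℕ→ℚ s
  deficit≤ k b n u s kn≤Ks+Ku = *-cancelˡ-≤-pos (ℕ→ℚ (suc b)) {{ℕ→ℚ-pos {suc b} (ℕ.s≤s ℕ.z≤n)}} (begin
    ℕ→ℚ (suc b) * deficit k b n u                  ≡⟨ K*deficit k b n u ⟩
    ℕ→ℚ (k ℕ.* n) - ℕ→ℚ (suc b ℕ.* u)             ≤⟨ x≤z+y⇒x-y≤z _ _ _ kn≤Ks+Ku′ ⟩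
    ℕ→ℚ (suc b ℕ.* s)                             ≡⟨ ℕ→ℚ-* (suc b) s ⟩
    ℕ→ℚ (suc b) * ℕ→ℚ s                           ∎)
    where
    open ≤-Reasoning
    kn≤Ks+Ku′ : ℕ→ℚ (k ℕ.* n) ≤ ℕ→ℚ (suc b ℕ.* s) + ℕ→ℚ (suc b ℕ.* u)
    kn≤Ks+Ku′ = subst (ℕ→ℚ (k ℕ.* n) ≤_) (ℕ→ℚ-+ (suc b ℕ.* s) _) (ℕ→ℚ-mono-≤ kn≤Ks+Ku)

  deficit≤0 : ∀ k b n u → k ℕ.* n ℕ.≤ suc b ℕ.* u → deficit k b n u ≤ 0ℚ
  deficit≤0 k b n u kn≤Ku =
    deficit≤ k b n u 0 (subst (k ℕ.* n ℕ.≤_) (cong (ℕ._+ suc b ℕ.* u) (≡.sym (ℕ.*-zeroʳ (suc b)))) kn≤Ku)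

  0≤deficit : ∀ k b n u → suc b ℕ.* u ℕ.≤ k ℕ.* n → 0ℚ ≤ deficit k b n u
  0≤deficit k b n u Ku≤kn = *-cancelˡ-≤-pos (ℕ→ℚ (suc b)) {{ℕ→ℚ-pos {suc b} (ℕ.s≤s ℕ.z≤n)}} (begin
    ℕ→ℚ (suc b) * 0ℚ                                ≡⟨ *-zeroʳ (ℕ→ℚ (suc b)) ⟩
    0ℚ                                              ≤⟨ y≤x⇒0≤x-y _ _ (ℕ→ℚ-mono-≤ Ku≤kn) ⟩
    ℕ→ℚ (k ℕ.* n) - ℕ→ℚ (suc b ℕ.* u)               ≡⟨ K*deficit k b n u ⟨
    ℕ→ℚ (suc b) * deficit k b n u                  ∎)
    where open ≤-Reasoning

  [1-ε]C<e⇒g<εC : ∀ {ε} e g C → e ℕ.+ g ℕ.≤ C → (1ℚ - ε) * ℕ→ℚ C < ℕ→ℚ e → ℕ→ℚ g < ε * ℕ→ℚ C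
  [1-ε]C<e⇒g<εC {ε} e g C e+g≤C dense = begin-strict
    ℕ→ℚ g                                        ≡⟨ cancel a (ℕ→ℚ g) ⟨
    a + ℕ→ℚ g - a                                <⟨ +-monoˡ-< (- a) (begin-strict
                                                       a + ℕ→ℚ g          <⟨ +-monoˡ-< (ℕ→ℚ g) dense ⟩
                                                       ℕ→ℚ e + ℕ→ℚ g      ≡⟨ ℕ→ℚ-+ e g ⟨
                                                       ℕ→ℚ (e ℕ.+ g)      ≤⟨ ℕ→ℚ-mono-≤ e+g≤C ⟩
                                                       ℕ→ℚ C              ∎) ⟩
    ℕ→ℚ C - a                                    ≡⟨ complement ε (ℕ→ℚ C) ⟩
    ε * ℕ→ℚ C                                    ∎
    where
    open ≤-Reasoning
    a = (1ℚ - ε) * ℕ→ℚ C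
    cancel : ∀ a b → a + b - a ≡ b
    cancel = solve 2 (λ a b → a :+ b :- a := b) refl
    complement : ∀ e c → c - (1ℚ - e) * c ≡ e * c
    complement = solve 2 (λ e c → c :- (con 1ℚ :- e) :* c := e :* c) refl

  s*F≤ε*n*D : ∀ {ε} s F C n D g → s ℕ.* F ℕ.* C ℕ.≤ n ℕ.* D ℕ.* g → ℕ→ℚ g < ε * ℕ→ℚ C →
    ℕ→ℚ (s ℕ.* F) ≤ ε * ℕ→ℚ (n ℕ.* D)
  s*F≤ε*n*D {ε} s F zero n D g _ g<0 =
    ⊥-elim (<-irrefl refl (≤-<-trans (nonNegative⁻¹ (ℕ→ℚ g) {{ℕ→ℚ-nonNeg g}}) (subst (ℕ→ℚ g <_) (*-zeroʳ ε) g<0)))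
  s*F≤ε*n*D {ε} s F C@(suc _) n D g sFC≤nDg g<εC = *-cancelʳ-≤-pos (ℕ→ℚ C) {{ℕ→ℚ-pos {C} (ℕ.s≤s ℕ.z≤n)}} (begin
    ℕ→ℚ (s ℕ.* F) * ℕ→ℚ C       ≡⟨ ℕ→ℚ-* (s ℕ.* F) C ⟨
    ℕ→ℚ (s ℕ.* F ℕ.* C)         ≤⟨ ℕ→ℚ-mono-≤ sFC≤nDg ⟩
    ℕ→ℚ (n ℕ.* D ℕ.* g)         ≡⟨ ℕ→ℚ-* (n ℕ.* D) g ⟩
    ℕ→ℚ (n ℕ.* D) * ℕ→ℚ g       ≤⟨ *-monoˡ-≤-nonNeg (ℕ→ℚ (n ℕ.* D)) {{ℕ→ℚ-nonNeg (n ℕ.* D)}} (<⇒≤ g<εC) ⟩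
    ℕ→ℚ (n ℕ.* D) * (ε * ℕ→ℚ C) ≡⟨ x∙yz≈y∙xz' (ℕ→ℚ (n ℕ.* D)) ε (ℕ→ℚ C) ⟩
    ε * ℕ→ℚ (n ℕ.* D) * ℕ→ℚ C   ∎)
    where
    open ≤-Reasoning
    x∙yz≈y∙xz' : ∀ a e c → a * (e * c) ≡ e * a * c
    x∙yz≈y∙xz' = solve 3 (λ a e c → a :* (e :* c) := e :* a :* c) refl

  square-mono : ∀ {x y} → 0ℚ ≤ x → x ≤ y → x * x ≤ y * y
  square-mono {x} {y} 0≤x x≤y = ≤-trans (*-monoˡ-≤-nonNeg x {{nonNegative 0≤x}} x≤y)
                                        (*-monoʳ-≤-nonNeg y {{nonNegative (≤-trans 0≤x x≤y)}} x≤y)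

  s²≤εn² : ∀ {ε} s F n D P → 0 ℕ.< F → 0ℚ < ε →
    ℕ→ℚ (s ℕ.* F) ≤ ε * ℕ→ℚ (n ℕ.* D) → D ℕ.* D ℕ.≤ P ℕ.* (F ℕ.* F) → ε * ℕ→ℚ P ≤ 1ℚ →
    ℕ→ℚ s * ℕ→ℚ s ≤ ε * (ℕ→ℚ n * ℕ→ℚ n)
  s²≤εn² {ε} s F n D P 0<F 0<ε sF≤εnD D²≤PF² εP≤1 = *-cancelʳ-≤-pos (f * f) (begin
    ℕ→ℚ s * ℕ→ℚ s * (f * f)                  ≡⟨ regroup₁ (ℕ→ℚ s) f ⟩
    (ℕ→ℚ s * f) * (ℕ→ℚ s * f)                ≡⟨ cong (λ t → t * t) (ℕ→ℚ-* s F) ⟨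
    ℕ→ℚ (s ℕ.* F) * ℕ→ℚ (s ℕ.* F)            ≤⟨ square-mono (nonNegative⁻¹ _ {{ℕ→ℚ-nonNeg (s ℕ.* F)}}) sF≤εnD ⟩
    ε * ℕ→ℚ (n ℕ.* D) * (ε * ℕ→ℚ (n ℕ.* D))  ≡⟨ cong (λ t → ε * t * (ε * t)) (ℕ→ℚ-* n D) ⟩
    ε * (m * d) * (ε * (m * d))               ≡⟨ regroup₂ ε m d ⟩
    ε * ε * (m * m) * (d * d)                 ≤⟨ *-monoˡ-≤-nonNeg (ε * ε * (m * m)) {{ε²m²-nonNeg}} d²≤pf² ⟩
    ε * ε * (m * m) * (p * (f * f))           ≡⟨ regroup₃ ε m p f ⟩
    ε * (m * m) * (f * f) * (ε * p)           ≤⟨ *-monoˡ-≤-nonNeg (ε * (m * m) * (f * f)) {{εm²f²-nonNeg}} εP≤1 ⟩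
    ε * (m * m) * (f * f) * 1ℚ                ≡⟨ *-identityʳ _ ⟩
    ε * (m * m) * (f * f)                     ∎)
    where
    open ≤-Reasoning
    f d p m : ℚ
    f = ℕ→ℚ F
    d = ℕ→ℚ D
    p = ℕ→ℚ P
    m = ℕ→ℚ n
    instance
      ε-nonNeg : NonNegative ε
      ε-nonNeg = pos⇒nonNeg ε {{positive 0<ε}}
      m²-nonNeg : NonNegative (m * m)
      m²-nonNeg = nonNeg*nonNeg⇒nonNeg m {{ℕ→ℚ-nonNeg n}} m {{ℕ→ℚ-nonNeg n}}
      f²-pos : Positive (f * f)
      f²-pos = pos*pos⇒pos f {{ℕ→ℚ-pos 0<F}} f {{ℕ→ℚ-pos 0<F}}
    ε²m²-nonNeg : NonNegative (ε * ε * (m * m))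
    ε²m²-nonNeg = nonNeg*nonNeg⇒nonNeg (ε * ε) {{nonNeg*nonNeg⇒nonNeg ε ε}} (m * m)
    εm²f²-nonNeg : NonNegative (ε * (m * m) * (f * f))
    εm²f²-nonNeg = nonNeg*nonNeg⇒nonNeg (ε * (m * m)) {{nonNeg*nonNeg⇒nonNeg ε (m * m)}} (f * f) {{pos⇒nonNeg (f * f)}}
    d²≤pf² : d * d ≤ p * (f * f)
    d²≤pf² = subst₂ _≤_ (ℕ→ℚ-* D D) (trans (ℕ→ℚ-* P (F ℕ.* F)) (cong (p *_) (ℕ→ℚ-* F F)))
                        (ℕ→ℚ-mono-≤ D²≤PF²)
    regroup₁ : ∀ s f → s * s * (f * f) ≡ (s * f) * (s * f)
    regroup₁ = solve 2 (λ s f → s :* s :* (f :* f) := (s :* f) :* (s :* f)) refl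
    regroup₂ : ∀ e m d → e * (m * d) * (e * (m * d)) ≡ e * e * (m * m) * (d * d)
    regroup₂ = solve 3 (λ e m d → e :* (m :* d) :* (e :* (m :* d)) := e :* e :* (m :* m) :* (d :* d)) refl
    regroup₃ : ∀ e m p f → e * e * (m * m) * (p * (f * f)) ≡ e * (m * m) * (f * f) * (e * p)
    regroup₃ = solve 4 (λ e m p f → e :* e :* (m :* m) :* (p :* (f :* f)) := e :* (m :* m) :* (f :* f) :* (e :* p)) refl

open import Defs
open import Data.Nat using (ℕ; _≤_; _<_; _^_)
open import Data.Nat.Combinatorics using (_C_)
open import Data.Rational using (ℚ; _+_; _-_; _*_; 0ℚ; 1ℚ) renaming (_≤_ to _≤ℚ_; _<_ to _<ℚ_)
open import Data.Fin using (Fin)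
open import Data.Fin.Subset using (Subset; ∣_∣)
open import Data.List using (List; length)
open import Data.List.Relation.Unary.All using (All)
open import Data.List.Relation.Unary.Unique.Propositional using (Unique)
open import Data.Product using (Σ; ∃; _×_)
open import Data.Sum using (_⊎_)
open import Relation.Binary.PropositionalEquality using (_≡_)

import Data.Nat as ℕ
open import Data.Nat.Properties using (≤-<-connex; <⇒≤; m≤m+n; +-monoʳ-≤; +-comm; ≤-<-trans; *-monoʳ-≤; 1≤n!)
open import Data.Nat.Combinatorics.Base using (_P′_)
open import Data.Nat.Combinatorics.Specification using (nP′n≡n!)
import Data.Rational.Properties as ℚ
open import Data.Fin.Subset using (⊤; _─_)
open import Data.Product using (_,_)
import Data.Sum as Sum
open import Relation.Binary.PropositionalEquality using (subst; sym)
open Counting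
open Rationals

deficit[largest]²≤εn² : ∀ {n} j ℓ (U : Fin (ℕ.suc j ℕ.+ ℕ.suc ℓ) → Subset n) {ε} →
  0ℚ <ℚ ε → ε * ℕ→ℚ (256 ^ ℕ.suc j) ≤ℚ 1ℚ →
  ℕ→ℚ (#uncovered U ⊤ᶠ ⊤ (ℕ.suc j)) <ℚ ε * ℕ→ℚ (n C ℕ.suc j) →
  (ℕ.suc j ℕ.+ ℕ.suc ℓ) ℕ.* ∣ U (largest U) ∣ < ℕ.suc j ℕ.* n →
  let d = deficit (ℕ.suc j) (j ℕ.+ ℕ.suc ℓ) n ∣ U (largest U) ∣ in
  d * d ≤ℚ ε * (ℕ→ℚ n * ℕ→ℚ n)
deficit[largest]²≤εn² {n} j ℓ U {ε} 0<ε ε256ᵏ≤1 few Ku<kn =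
  ℚ.≤-trans (square-mono (0≤deficit k b n u (<⇒≤ Ku<kn)) d≤s) s²≤εn²′
  where
  k K b u s : ℕ
  k = ℕ.suc j
  b = j ℕ.+ ℕ.suc ℓ
  K = ℕ.suc b
  u = ∣ U (largest U) ∣
  s = #lowDegree U k
  d≤s : deficit k b n u ≤ℚ ℕ→ℚ s
  d≤s = deficit≤ k b n u s (k*n≤K*#lowDegree+K*∣U[largest]∣ U k (m≤m+n k (ℕ.suc ℓ)))
  n≤[1+k]*∣⊤─U∣ : ∀ i → n ≤ (2 ℕ.+ j) ℕ.* ∣ ⊤ ─ U i ∣
  n≤[1+k]*∣⊤─U∣ i = n≤[1+k]*∣⊤─p∣ k (U i) (subst (_≤ K) (+-comm k 1) (+-monoʳ-≤ k (ℕ.s≤s {n = ℓ} ℕ.z≤n)))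
                    (≤-<-trans (*-monoʳ-≤ K (∣U∣≤∣U[largest]∣ U i)) Ku<kn)
  s²≤εn²′ : ℕ→ℚ s * ℕ→ℚ s ≤ℚ ε * (ℕ→ℚ n * ℕ→ℚ n)
  s²≤εn²′ = s²≤εn² s (j P′ j) n ((2 ℕ.* (2 ℕ.+ j)) ^ j) (256 ^ k) 0<j! 0<ε
              (s*F≤ε*n*D {ε} s (j P′ j) (n C k) n _ _ (#lowDegree*F*C≤n*D*#uncovered U j n≤[1+k]*∣⊤─U∣) few)
              (D²≤256^[1+j]*F² j) ε256ᵏ≤1
    where
    0<j! : 0 < j P′ j
    0<j! = subst (0 <_) (sym (nP′n≡n! j)) (1≤n! j)

lemma6p3 : (k ℓ : ℕ) → 2 ≤ k → 1 ≤ ℓ →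
    (ε : ℚ) → 0ℚ <ℚ ε → ε * ℕ→ℚ (256 ^ k) <ℚ 1ℚ →
    Σ ℕ λ n₀ → 0 < n₀ ×
      ((n : ℕ) → n₀ ≤ n →
       (edges : List (Subset n)) → Unique edges → All (λ e → ∣ e ∣ ≡ k) edges →
       (1ℚ - ε) * ℕ→ℚ (n C k) <ℚ ℕ→ℚ (length edges) →
       (colour : Subset n → Fin (k Data.Nat.+ ℓ)) →
       ∃ λ i →
         let d = frac k (k Data.Nat.+ ℓ) * ℕ→ℚ n - ℕ→ℚ ∣ monoCore colour edges i ∣ in
         d ≤ℚ 0ℚ ⊎ d * d ≤ℚ ε * (ℕ→ℚ n * ℕ→ℚ n))
-- The bounds hold for every n, so n₀ = 1.
lemma6p3 (ℕ.suc j) (ℕ.suc ℓ) (ℕ.s≤s _) (ℕ.s≤s _) ε 0<ε ε256ᵏ<1 =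
  1 , ℕ.s≤s ℕ.z≤n , λ n _ edges unique sizes dense colour →
    let U   = monoCore colour edges
        few = [1-ε]C<e⇒g<εC {ε} (length edges) _ (n C ℕ.suc j)
                (edges+#uncovered≤nCk colour edges (ℕ.suc j) unique sizes) dense
    in largest U , Sum.map (deficit≤0 (ℕ.suc j) (j ℕ.+ ℕ.suc ℓ) n _)
                           (deficit[largest]²≤εn² j ℓ U 0<ε (ℚ.<⇒≤ ε256ᵏ<1) few)
                           (≤-<-connex _ _)
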